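{- Call a quadruple $(\alpha,l,l^*,t)$ of non-negative integers admissible if $\alpha>0$, $ll^*=\alpha(\alpha-1)$, and $\alpha$ divides $(l+l^*)^2t$. Then the assignment sending an admissible quadruple $(\alpha,l,l^*,t)$ to $$n=l+l^*+2\alpha,\quad m=\tfrac{t}{\alpha}n^2+n+1,\quad \mu=(n-1)t+\alpha,$$ $$b=mn,\quad v=n^2\big((n-1)\tfrac{t}{\alpha}+1\big),\quad r=m(\alpha+l),\quad k=n\big((n-1)\tfrac{t}{\alpha}+1\big)(\alpha+l),$$ $$\lambda=\big(\tfrac{t}{\alpha}n+1\big)(\alpha+l)^2+l,\quad \lambda_1=n\big((n-1)\tfrac{t}{\alpha}+1\big)l,\quad \lambda_2=\big((n-1)\tfrac{t}{\alpha}+1\big)(\alpha+l)^2$$ is a bijection between admissible quadruples and the feasible parameter sets of strongly resolvable 2-designs, i.e. tuples $(m,n,\mu,b,v,r,k,\lambda,\lambda_1,\lambda_2)$ with $m,n\ge 2$, $\mu\ge1$, such that $(K_{m\times n},\mu)$ is feasible and $(b,v,r,k,\lambda,\lambda_1,\lambda_2)$ is one of the two parameter sets attached to $(K_{m\times n},\mu)$. Consequently, the only feasible parameters of strongly resolvable 2-designs of defect $1$ are those of affine planes ($2$-$(n^2,n,1)$ designs) and their complements, and for each $\mu>1$ there are only finitely many feasible parameter sets of strongly resolvable 2-designs of defect $\mu$.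
   Context: For $m,n\ge2$, $K_{m\times n}$ is the complete multipartite graph on $mn$ vertices partitioned into $m$ parts of size $n$, two vertices adjacent iff in different parts. A strongly resolvable 2-design is a quasi-symmetric 2-design (a 2-design with exactly two block intersection numbers $\lambda_1<\lambda_2$, defect $\mu=\lambda_2-\lambda_1$) whose block graph (blocks adjacent iff they meet in $\lambda_2$ points) is $K_{m\times n}$. For a connected non-complete strongly regular graph $G$ with eigenvalues $a>\rho>\sigma$ of multiplicities $1,f,g$, and a positive integer $\mu$: set $v=f+1$, $b=f+g+1$, and for each root $\lambda$ of $x^2-(f+g+1-2(\rho-\sigma)\mu)x+(\rho-\sigma)\mu((\rho-\sigma)\mu-\frac{f+g+1}{f+1})=0$ set $r=\lambda+(\rho-\sigma)\mu$, $\lambda_1=\frac{(f+1)(\lambda+\rho\mu)+g\sigma\mu}{f+g+1}$, $\lambda_2=\lambda_1+\mu$, $k=\lambda_1-\sigma\mu$; these two tuples $(b,v,r,k,\lambda,\lambda_1,\lambda_2)$ are the parameter sets attached to $(G,\mu)$. The pair $(G,\mu)$ is feasible if for both roots all these are non-negative integers satisfying $bk=rv$, $r(k-1)=\lambda(v-1)$. -}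

module Defs where

open import Data.Nat using (ℕ; zero; suc; _+_; _*_; _∸_; _^_; _≤_; _<_)
open import Data.Nat.DivMod using (_/_)
open import Data.Nat.Divisibility using (_∣_)
open import Data.Integer as ℤ using (ℤ; +_)
open import Data.Product using (Σ; ∃; _×_; _,_)
open import Data.Sum using (_⊎_)
open import Relation.Binary.PropositionalEquality using (_≡_)

-- Generic parameter sets attached to (G , μ), where G is a connected
-- non-complete strongly regular graph with eigenvalues a > ρ > σ of
-- multiplicities 1, f, g.  Everything is phrased in ℤ; the only
-- rational number in the defining quadratic ((f+g+1)/(f+1)) is cleared
-- by multiplying the equation by f+1 (which is > 0).

module _ (f g : ℕ) (ρ σ : ℤ) (μ : ℕ) where

  private
    F1 : ℤ
    F1 = + (f + 1)
    FG1 : ℤ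
    FG1 = + (f + g + 1)
    dμ : ℤ
    dμ = (ρ ℤ.- σ) ℤ.* (+ μ)

  coeffB : ℤ
  coeffB = FG1 ℤ.- (+ 2) ℤ.* dμ

  -- (f+1) times the constant term (ρ-σ)μ((ρ-σ)μ - (f+g+1)/(f+1))
  coeffC' : ℤ
  coeffC' = dμ ℤ.* (F1 ℤ.* dμ ℤ.- FG1)

  IsRoot : ℤ → Set
  IsRoot x = F1 ℤ.* (x ℤ.* x) ℤ.- F1 ℤ.* (coeffB ℤ.* x) ℤ.+ coeffC' ≡ + 0

  ParamsFrom : (b v r k lam lam₁ lam₂ : ℕ) → Set
  ParamsFrom b v r k lam lam₁ lam₂ =
    (b ≡ f + g + 1) × (v ≡ f + 1) ×
    (+ r ≡ + lam ℤ.+ dμ) ×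
    (FG1 ℤ.* + lam₁ ≡ F1 ℤ.* (+ lam ℤ.+ ρ ℤ.* + μ) ℤ.+ (+ g) ℤ.* σ ℤ.* (+ μ)) ×
    (lam₂ ≡ lam₁ + μ) ×
    (+ k ≡ + lam₁ ℤ.- σ ℤ.* (+ μ))

  DesignEqs : (b v r k lam : ℕ) → Set
  DesignEqs b v r k lam =
    (b * k ≡ r * v) × ((+ r) ℤ.* (+ k ℤ.- + 1) ≡ (+ lam) ℤ.* (+ v ℤ.- + 1))

  GoodRoot : ℕ → Set
  GoodRoot lam = Σ ℕ λ b → Σ ℕ λ v → Σ ℕ λ r → Σ ℕ λ k → Σ ℕ λ lam₁ → Σ ℕ λ lam₂ →
    ParamsFrom b v r k lam lam₁ lam₂ × DesignEqs b v r k lam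

  -- (G , μ) is feasible: both roots (x and y, listed with multiplicity,
  -- identified via Vieta's formulas) are non-negative integers, and for
  -- each of them all derived quantities are non-negative integers
  -- satisfying the design equations.
  Feasible : Set
  Feasible = Σ ℕ λ x → Σ ℕ λ y →
    (+ x ℤ.+ + y ≡ coeffB) × (F1 ℤ.* (+ x ℤ.* + y) ≡ coeffC') ×
    GoodRoot x × GoodRoot y

  Attached : (b v r k lam lam₁ lam₂ : ℕ) → Set
  Attached b v r k lam lam₁ lam₂ = IsRoot (+ lam) × ParamsFrom b v r k lam lam₁ lam₂

-- Spectrum of K_{m×n}: eigenvalues (m-1)n > 0 > -n with multiplicities
-- 1, f = m(n-1), g = m-1.

Kf : ℕ → ℕ → ℕ
Kf m n = m * (n ∸ 1)

Kg : ℕ → ℕ → ℕ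
Kg m n = m ∸ 1

Kρ : ℕ → ℕ → ℤ
Kρ m n = + 0

Kσ : ℕ → ℕ → ℤ
Kσ m n = ℤ.- (+ n)

record Params : Set where
  constructor params
  field
    m n μ b v r k lam lam₁ lam₂ : ℕ

open Params public

FeasibleSRD : Params → Set
FeasibleSRD p =
  (2 ≤ m p) × (2 ≤ n p) × (1 ≤ μ p) ×
  Feasible (Kf (m p) (n p)) (Kg (m p) (n p)) (Kρ (m p) (n p)) (Kσ (m p) (n p)) (μ p) ×
  Attached (Kf (m p) (n p)) (Kg (m p) (n p)) (Kρ (m p) (n p)) (Kσ (m p) (n p)) (μ p)
    (b p) (v p) (r p) (k p) (lam p) (lam₁ p) (lam₂ p)

Quad : Set
Quad = ℕ × ℕ × ℕ × ℕ

Admissible : Quad → Set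
Admissible (α , l , ls , t) =
  (0 < α) × (l * ls ≡ α * (α ∸ 1)) × (α ∣ (l + ls) ^ 2 * t)

-- exact division by α (α > 0 for admissible quadruples; the value at
-- α = 0 is irrelevant)
divα : ℕ → ℕ → ℕ
divα x zero = 0
divα x (suc a) = x / suc a

-- x/α with the rational expressions of the paper cleared:
-- (n-1)t/α + 1 = ((n-1)t + α)/α
assign : Quad → Params
assign (α , l , ls , t) =
  params mm nn ((nn ∸ 1) * t + α) (mm * nn)
    (divα (nn * nn * q) α)
    (mm * (α + l))
    (divα (nn * q * (α + l)) α)
    (divα ((t * nn + α) * ((α + l) * (α + l))) α + l)
    (divα (nn * q * l) α)
    (divα (q * ((α + l) * (α + l))) α)
  where
    nn : ℕ
    nn = l + ls + 2 * α
    mm : ℕ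
    mm = divα (t * (nn * nn)) α + nn + 1
    q : ℕ
    q = (nn ∸ 1) * t + α

affinePlane : ℕ → Params
affinePlane q = params (q + 1) q 1 (q * (q + 1)) (q * q) (q + 1) q 1 0 1

affineComplement : ℕ → Params
affineComplement q =
  params (q + 1) q 1 (q * (q + 1)) (q * q) (q * q ∸ 1) (q * q ∸ q)
    (q * q ∸ q ∸ 1) (q * q ∸ 2 * q) (q * q ∸ 2 * q + 1)

module Submission where

open import Defs
open import Data.Nat
  using (ℕ; zero; suc; _+_; _*_; _∸_; _^_; _≤_; _<_; s≤s; z≤n; NonZero; >-nonZero; ≢-nonZero; ≢-nonZero⁻¹)
import Data.Nat.Properties as ℕ
open import Data.Nat.Divisibility
open import Data.Nat.DivMod using (_/_; m*[n/m]≡n)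
open import Data.Nat.GCD using (gcd; gcd[m,n]∣m; gcd[m,n]∣n; gcd[m,n]≢0)
open import Data.Nat.Coprimality using (Coprime; coprime-/gcd; coprime-divisor)
open import Data.Nat.Tactic.RingSolver using (solve-∀)
open import Data.Integer as ℤ using (ℤ; +_)
import Data.Integer.Properties as ℤ
open import Data.Integer.Tactic.RingSolver using () renaming (solve-∀ to ℤ-solve-∀)
open import Data.Product using (Σ; _×_; _,_; proj₁; proj₂)
open import Data.Sum using (_⊎_; inj₁; inj₂)
open import Data.Empty using (⊥-elim)
open import Data.List using (List; map; cartesianProduct; upTo)
open import Data.List.Membership.Propositional using (_∈_)
open import Data.List.Membership.Propositional.Properties using (∈-map⁺; ∈-cartesianProduct⁺; ∈-upTo⁺)
open import Function.Bundles using (_⇔_; mk⇔; Equivalence)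
open import Relation.Binary.PropositionalEquality

-- For K_{m×n} we have f = m(n-1), g = m-1, ρ = 0, σ = -n, so every root λ comes with
-- r = λ + nμ and v = F = m(n-1)+1, and bk = rv reads mn·k = r·F.  As F is coprime to m, r = m s;
-- for the two roots s + s₂ = n, and Vieta's product formula becomes F s s₂ = (n-1) n² μ.
-- As F is also coprime to n-1, s s₂ = α(n-1) with F α = n² μ.  Putting s = α + l, s₂ = α + l*
-- gives l l* = α(α-1); moreover μ ≡ α mod n-1 and α ≤ n/2 force μ = (n-1)t + α, and then
-- α m = t n² + (n+1)α, so α ∣ (l+l*)² t.  Conversely an admissible quadruple yields integral
-- parameters, those of the second root being the ones of the quadruple (α, l*, l, t).

∣⇒coprime-+1 : ∀ {a c} → a ∣ c → Coprime a (c + 1)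
∣⇒coprime-+1 a∣c (d∣a , d∣c+1) = ∣1⇒≡1 (∣m+n∣m⇒∣n d∣c+1 (∣-trans d∣a a∣c))

∣-affine : ∀ {d x y} c z → d ∣ y → x ≡ c * y + d * z → d ∣ x
∣-affine c z d∣y refl = ∣m∣n⇒∣m+n (∣n⇒∣m*n c d∣y) (m∣m*n z)

-- With g = gcd d x write d = g A and x = g X, A and X coprime: A² ∣ X Y forces A ∣ Y,
-- then A ∣ X + Y gives A ∣ X, so A = 1.
d∣x+y⇒d*d∣x*y⇒d∣x : ∀ d {x y} → .{{NonZero d}} → d ∣ x + y → d * d ∣ x * y → d ∣ x
d∣x+y⇒d*d∣x*y⇒d∣x d {x} {y} d∣x+y d²∣xy = subst (_∣ x) g≡d (gcd[m,n]∣n d x)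
  where
  g : ℕ
  g = gcd d x
  instance
    g-nonZero : NonZero g
    g-nonZero = ≢-nonZero (gcd[m,n]≢0 d x (inj₁ (≢-nonZero⁻¹ d)))
  A X Y : ℕ
  A = d / g
  X = x / g
  Y = y / g
  g*A≡d : g * A ≡ d
  g*A≡d = m*[n/m]≡n (gcd[m,n]∣m d x)
  g*X≡x : g * X ≡ x
  g*X≡x = m*[n/m]≡n (gcd[m,n]∣n d x)
  g*Y≡y : g * Y ≡ y
  g*Y≡y = m*[n/m]≡n (∣m+n∣m⇒∣n (∣-trans (gcd[m,n]∣m d x) d∣x+y) (gcd[m,n]∣n d x))
  coprime : Coprime A X
  coprime = coprime-/gcd d x
  ring : ∀ g a b → (g * a) * (g * b) ≡ g * (g * (a * b))
  ring = solve-∀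
  A*A∣X*Y : A * A ∣ X * Y
  A*A∣X*Y = *-cancelˡ-∣ g (*-cancelˡ-∣ g (subst₂ _∣_
    (trans (cong₂ _*_ (sym g*A≡d) (sym g*A≡d)) (ring g A A))
    (trans (cong₂ _*_ (sym g*X≡x) (sym g*Y≡y)) (ring g X Y)) d²∣xy))
  A∣Y : A ∣ Y
  A∣Y = coprime-divisor coprime (m*n∣⇒m∣ A A A*A∣X*Y)
  A∣X : A ∣ X
  A∣X = ∣m+n∣m⇒∣n (*-cancelˡ-∣ g (subst₂ _∣_ (sym g*A≡d)
    (trans (cong₂ _+_ (sym g*Y≡y) (sym g*X≡x)) (sym (ℕ.*-distribˡ-+ g Y X)))
    (subst (d ∣_) (ℕ.+-comm x y) d∣x+y))) A∣Y
  g≡d : g ≡ d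
  g≡d = trans (sym (ℕ.*-identityʳ g)) (trans (cong (g *_) (sym (coprime (∣-refl , A∣X)))) g*A≡d)

k*x+a≡k*y+b⇒b≡k*t+a : ∀ k x y {a b} → k * x + a ≡ k * y + b → a < k + b → Σ ℕ λ t → b ≡ k * t + a
k*x+a≡k*y+b⇒b≡k*t+a k x y {a} {b} e a<k+b with ℕ.≤-total y x
... | inj₁ y≤x with ℕ.m≤n⇒∃[o]m+o≡n y≤x
...   | t , y+t≡x = t , ℕ.+-cancelˡ-≡ (k * y) _ _ (begin
        k * y + b             ≡⟨ sym e ⟩
        k * x + a             ≡⟨ cong (λ z → k * z + a) (sym y+t≡x) ⟩
        k * (y + t) + a       ≡⟨ ring k y t a ⟩
        k * y + (k * t + a)   ∎)
  where
  open ≡-Reasoning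
  ring : ∀ k y t a → k * (y + t) + a ≡ k * y + (k * t + a)
  ring = solve-∀
k*x+a≡k*y+b⇒b≡k*t+a k x y {a} {b} e a<k+b | inj₂ x≤y with ℕ.m≤n⇒∃[o]m+o≡n x≤y
... | zero , x+0≡y = 0 , ℕ.+-cancelˡ-≡ (k * x) _ _ (begin
        k * x + b             ≡⟨ cong (λ z → k * z + b) (trans (sym (ℕ.+-identityʳ x)) x+0≡y) ⟩
        k * y + b             ≡⟨ sym e ⟩
        k * x + a             ≡⟨ cong (λ z → k * x + (z + a)) (sym (ℕ.*-zeroʳ k)) ⟩
        k * x + (k * 0 + a)   ∎)
  where open ≡-Reasoning
... | suc e′ , x+e≡y = ⊥-elim (ℕ.<-irrefl refl (ℕ.<-≤-trans a<k+b (begin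
        k + b                 ≤⟨ ℕ.+-monoˡ-≤ b (ℕ.m≤m*n k (suc e′)) ⟩
        k * suc e′ + b        ≡⟨ ℕ.+-cancelˡ-≡ (k * x) _ _ (begin-equality
          k * x + (k * suc e′ + b)   ≡⟨ ring k x (suc e′) b ⟩
          k * (x + suc e′) + b       ≡⟨ cong (λ z → k * z + b) x+e≡y ⟩
          k * y + b                  ≡⟨ sym e ⟩
          k * x + a                  ∎) ⟩
        a                     ∎)))
  where
  open ℕ.≤-Reasoning
  ring : ∀ k x e b → k * x + (k * e + b) ≡ k * (x + e) + b
  ring = solve-∀

m≡n+o⇒m∸o≡n : ∀ {m n o} → m ≡ n + o → m ∸ o ≡ n
m≡n+o⇒m∸o≡n {n = n} {o} refl = ℕ.m+n∸n≡m n o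

-- The defining equations over ℕ, for eigenvalues ρ = 0 and σ = -n

+-cancelʳ-ℤ : ∀ {a c} q → a ℤ.+ q ≡ c ℤ.+ q → a ≡ c
+-cancelʳ-ℤ {a} {c} q e = begin
  a                 ≡⟨ ring a q ⟩
  (a ℤ.+ q) ℤ.- q   ≡⟨ cong (ℤ._- q) e ⟩
  (c ℤ.+ q) ℤ.- q   ≡⟨ sym (ring c q) ⟩
  c                 ∎
  where
  open ≡-Reasoning
  ring : ∀ x y → x ≡ (x ℤ.+ y) ℤ.- y
  ring = ℤ-solve-∀

transfer : ∀ {A C a c} q → + A ≡ a ℤ.+ q → + C ≡ c ℤ.+ q → (a ≡ c) ⇔ (A ≡ C)
transfer q eA eC = mk⇔
  (λ e → ℤ.+-injective (trans eA (trans (cong (ℤ._+ q) e) (sym eC))))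
  (λ e → +-cancelʳ-ℤ q (trans (sym eA) (trans (cong +_ e) eC)))

cast⇔ : ∀ {A C c} → + C ≡ c → (+ A ≡ c) ⇔ (A ≡ C)
cast⇔ eC = mk⇔ (λ e → ℤ.+-injective (trans e (sym eC))) (λ e → trans (cong +_ e) eC)

module Translation (f g n μ : ℕ) where

  F B D : ℕ
  F = f + 1
  B = f + g + 1
  D = n * μ

  σ : ℤ
  σ = ℤ.- (+ n)

  dμ≡D : (+ 0 ℤ.- σ) ℤ.* + μ ≡ + D
  dμ≡D = trans (ring (+ n) (+ μ)) (sym (ℤ.pos-* n μ))
    where
    ring : ∀ x y → (+ 0 ℤ.- ℤ.- x) ℤ.* y ≡ x ℤ.* y
    ring = ℤ-solve-∀

  record Vieta (x y : ℕ) : Set where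
    field
      sum     : x + y + 2 * D ≡ B
      product : F * (x * y) + D * B ≡ F * (D * D)

  record ParamsFromℕ (b v r k lam lam₁ lam₂ : ℕ) : Set where
    field
      b≡B              : b ≡ B
      v≡F              : v ≡ F
      r≡lam+D          : r ≡ lam + D
      B*lam₁+g*D≡F*lam : B * lam₁ + g * D ≡ F * lam
      lam₂≡lam₁+μ      : lam₂ ≡ lam₁ + μ
      k≡lam₁+D         : k ≡ lam₁ + D

    D≤k : D ≤ k
    D≤k = subst (D ≤_) (sym k≡lam₁+D) (ℕ.m≤n+m D lam₁)

  record DesignEqsℕ (b v r k lam : ℕ) : Set where
    field
      b*k≡r*v         : b * k ≡ r * v
      r*k+lam≡r+lam*v : r * k + lam ≡ r + lam * v

  GoodRootℕ : ℕ → Set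
  GoodRootℕ z = Σ ℕ λ b → Σ ℕ λ v → Σ ℕ λ r → Σ ℕ λ k → Σ ℕ λ lam₁ → Σ ℕ λ lam₂ →
    ParamsFromℕ b v r k z lam₁ lam₂ × DesignEqsℕ b v r k z

  Feasibleℕ : Set
  Feasibleℕ = Σ ℕ λ x → Σ ℕ λ y → Vieta x y × GoodRootℕ x × GoodRootℕ y

  sum⇔ : ∀ x y → (+ x ℤ.+ + y ≡ coeffB f g (+ 0) σ μ) ⇔ (x + y + 2 * D ≡ B)
  sum⇔ x y = transfer (+ 2 ℤ.* + D)
    (trans (ℤ.pos-+ (x + y) (2 * D)) (cong₂ ℤ._+_ (ℤ.pos-+ x y) (ℤ.pos-* 2 D)))
    (subst (λ d → + B ≡ (+ B ℤ.- + 2 ℤ.* d) ℤ.+ + 2 ℤ.* + D) (sym dμ≡D) (ring (+ B) (+ D)))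
    where
    ring : ∀ b d → b ≡ (b ℤ.- + 2 ℤ.* d) ℤ.+ + 2 ℤ.* d
    ring = ℤ-solve-∀

  product⇔ : ∀ x y → (+ F ℤ.* (+ x ℤ.* + y) ≡ coeffC' f g (+ 0) σ μ) ⇔ (F * (x * y) + D * B ≡ F * (D * D))
  product⇔ x y = transfer (+ D ℤ.* + B)
    (trans (ℤ.pos-+ (F * (x * y)) (D * B))
      (cong₂ ℤ._+_ (trans (ℤ.pos-* F (x * y)) (cong (ℤ._*_ (+ F)) (ℤ.pos-* x y))) (ℤ.pos-* D B)))
    (trans (trans (ℤ.pos-* F (D * D)) (cong (ℤ._*_ (+ F)) (ℤ.pos-* D D)))
      (subst (λ d → + F ℤ.* (+ D ℤ.* + D) ≡ d ℤ.* (+ F ℤ.* d ℤ.- + B) ℤ.+ + D ℤ.* + B)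
        (sym dμ≡D) (ring (+ F) (+ D) (+ B))))
    where
    ring : ∀ a d b → a ℤ.* (d ℤ.* d) ≡ d ℤ.* (a ℤ.* d ℤ.- b) ℤ.+ d ℤ.* b
    ring = ℤ-solve-∀

  paramsFrom⇔ : ∀ b v r k lam lam₁ lam₂ →
    ParamsFrom f g (+ 0) σ μ b v r k lam lam₁ lam₂ ⇔ ParamsFromℕ b v r k lam lam₁ lam₂
  paramsFrom⇔ b v r k lam lam₁ lam₂ = mk⇔
    (λ (eb , ev , er , e₁ , e₂ , ek) → record
       { b≡B = eb ; v≡F = ev ; r≡lam+D = to r⇔ er ; B*lam₁+g*D≡F*lam = to lam₁⇔ e₁
       ; lam₂≡lam₁+μ = e₂ ; k≡lam₁+D = to k⇔ ek })
    (λ P → let open ParamsFromℕ P in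
       b≡B , v≡F , from r⇔ r≡lam+D , from lam₁⇔ B*lam₁+g*D≡F*lam , lam₂≡lam₁+μ , from k⇔ k≡lam₁+D)
    where
    open Equivalence
    r⇔ : (+ r ≡ + lam ℤ.+ (+ 0 ℤ.- σ) ℤ.* + μ) ⇔ (r ≡ lam + D)
    r⇔ = cast⇔ (trans (ℤ.pos-+ lam D) (cong (ℤ._+_ (+ lam)) (sym dμ≡D)))
    ringk : ∀ l x y → l ℤ.+ x ℤ.* y ≡ l ℤ.- ℤ.- x ℤ.* y
    ringk = ℤ-solve-∀
    k⇔ : (+ k ≡ + lam₁ ℤ.- σ ℤ.* + μ) ⇔ (k ≡ lam₁ + D)
    k⇔ = cast⇔ (trans (ℤ.pos-+ lam₁ D)
      (trans (cong (ℤ._+_ (+ lam₁)) (ℤ.pos-* n μ)) (ringk (+ lam₁) (+ n) (+ μ))))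
    ring₁ : ∀ a l m c x → a ℤ.* l ≡ (a ℤ.* (l ℤ.+ + 0 ℤ.* m) ℤ.+ c ℤ.* ℤ.- x ℤ.* m) ℤ.+ c ℤ.* (x ℤ.* m)
    ring₁ = ℤ-solve-∀
    lam₁⇔ : (+ B ℤ.* + lam₁ ≡ + F ℤ.* (+ lam ℤ.+ + 0 ℤ.* + μ) ℤ.+ + g ℤ.* σ ℤ.* + μ)
            ⇔ (B * lam₁ + g * D ≡ F * lam)
    lam₁⇔ = transfer (+ g ℤ.* (+ n ℤ.* + μ))
      (trans (ℤ.pos-+ (B * lam₁) (g * D))
        (cong₂ ℤ._+_ (ℤ.pos-* B lam₁) (trans (ℤ.pos-* g D) (cong (ℤ._*_ (+ g)) (ℤ.pos-* n μ)))))
      (trans (ℤ.pos-* F lam) (ring₁ (+ F) (+ lam) (+ μ) (+ g) (+ n)))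

  designEqs⇔ : ∀ b v r k lam → DesignEqs f g (+ 0) σ μ b v r k lam ⇔ DesignEqsℕ b v r k lam
  designEqs⇔ b v r k lam = mk⇔
    (λ (e₁ , e₂) → record { b*k≡r*v = e₁ ; r*k+lam≡r+lam*v = Equivalence.to second⇔ e₂ })
    (λ E → let open DesignEqsℕ E in b*k≡r*v , Equivalence.from second⇔ r*k+lam≡r+lam*v)
    where
    ring : ∀ x y z → x ℤ.* y ℤ.+ z ≡ x ℤ.* (y ℤ.- + 1) ℤ.+ (x ℤ.+ z)
    ring = ℤ-solve-∀
    ring′ : ∀ x y z → x ℤ.+ y ℤ.* z ≡ y ℤ.* (z ℤ.- + 1) ℤ.+ (x ℤ.+ y)
    ring′ = ℤ-solve-∀
    second⇔ : (+ r ℤ.* (+ k ℤ.- + 1) ≡ + lam ℤ.* (+ v ℤ.- + 1)) ⇔ (r * k + lam ≡ r + lam * v)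
    second⇔ = transfer (+ r ℤ.+ + lam)
      (trans (trans (ℤ.pos-+ (r * k) lam) (cong (ℤ._+ + lam) (ℤ.pos-* r k))) (ring (+ r) (+ k) (+ lam)))
      (trans (trans (ℤ.pos-+ r (lam * v)) (cong (ℤ._+_ (+ r)) (ℤ.pos-* lam v))) (ring′ (+ r) (+ lam) (+ v)))

  goodRoot⇔ : ∀ z → GoodRoot f g (+ 0) σ μ z ⇔ GoodRootℕ z
  goodRoot⇔ z = mk⇔
    (λ (b , v , r , k , l₁ , l₂ , pf , de) →
       b , v , r , k , l₁ , l₂ , to (paramsFrom⇔ b v r k z l₁ l₂) pf , to (designEqs⇔ b v r k z) de)
    (λ (b , v , r , k , l₁ , l₂ , pf , de) →
       b , v , r , k , l₁ , l₂ , from (paramsFrom⇔ b v r k z l₁ l₂) pf , from (designEqs⇔ b v r k z) de)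
    where open Equivalence

  feasible⇔ : Feasible f g (+ 0) σ μ ⇔ Feasibleℕ
  feasible⇔ = mk⇔
    (λ (x , y , s , p , gx , gy) →
       x , y , record { sum = to (sum⇔ x y) s ; product = to (product⇔ x y) p } ,
       to (goodRoot⇔ x) gx , to (goodRoot⇔ y) gy)
    (λ (x , y , V , gx , gy) →
       x , y , from (sum⇔ x y) (Vieta.sum V) , from (product⇔ x y) (Vieta.product V) ,
       from (goodRoot⇔ x) gx , from (goodRoot⇔ y) gy)
    where open Equivalence

  isRoot⇔ : ∀ {x y} L → Vieta x y → IsRoot f g (+ 0) σ μ (+ L) ⇔ (L ≡ x ⊎ L ≡ y)
  isRoot⇔ {x} {y} L V = mk⇔ root⇒ ⇒root
    where
    ring : ∀ a l x y → a ℤ.* (l ℤ.* l) ℤ.- a ℤ.* ((x ℤ.+ y) ℤ.* l) ℤ.+ a ℤ.* (x ℤ.* y)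
                     ≡ a ℤ.* ((l ℤ.- x) ℤ.* (l ℤ.- y))
    ring = ℤ-solve-∀
    factor : + F ℤ.* (+ L ℤ.* + L) ℤ.- + F ℤ.* (coeffB f g (+ 0) σ μ ℤ.* + L) ℤ.+ coeffC' f g (+ 0) σ μ
             ≡ + F ℤ.* ((+ L ℤ.- + x) ℤ.* (+ L ℤ.- + y))
    factor = subst₂ (λ b c → + F ℤ.* (+ L ℤ.* + L) ℤ.- + F ℤ.* (b ℤ.* + L) ℤ.+ c ≡ _)
      (Equivalence.from (sum⇔ x y) (Vieta.sum V)) (Equivalence.from (product⇔ x y) (Vieta.product V))
      (ring (+ F) (+ L) (+ x) (+ y))
    root⇒ : IsRoot f g (+ 0) σ μ (+ L) → L ≡ x ⊎ L ≡ y
    root⇒ e with ℤ.i*j≡0⇒i≡0∨j≡0 (+ F) (trans (sym factor) e)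
    ... | inj₁ F≡0 with ℕ.m+n≡0⇒n≡0 f (ℤ.+-injective F≡0)
    ...   | ()
    root⇒ e | inj₂ e′ with ℤ.i*j≡0⇒i≡0∨j≡0 (+ L ℤ.- + x) e′
    ...   | inj₁ ex = inj₁ (ℤ.+-injective (ℤ.i-j≡0⇒i≡j _ _ ex))
    ...   | inj₂ ey = inj₂ (ℤ.+-injective (ℤ.i-j≡0⇒i≡j _ _ ey))
    zero-left : ∀ a x y → a ℤ.* ((x ℤ.- x) ℤ.* (x ℤ.- y)) ≡ + 0
    zero-left = ℤ-solve-∀
    zero-right : ∀ a x y → a ℤ.* ((y ℤ.- x) ℤ.* (y ℤ.- y)) ≡ + 0
    zero-right = ℤ-solve-∀
    ⇒root : L ≡ x ⊎ L ≡ y → IsRoot f g (+ 0) σ μ (+ L)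
    ⇒root (inj₁ refl) = trans factor (zero-left (+ F) (+ L) (+ y))
    ⇒root (inj₂ refl) = trans factor (zero-right (+ F) (+ x) (+ L))

-- Spectral description of the parameter sets of K_{m×n}, where m = M = suc m′ and n = N = suc n′

module Multipartite (m′ n′ μ : ℕ) where

  M N : ℕ
  M = suc m′
  N = suc n′

  open Translation (M * n′) m′ N μ public

  M*N≡B : M * N ≡ B
  M*N≡B = ring m′ n′
    where
    ring : ∀ a b → suc a * suc b ≡ suc a * b + a + 1
    ring = solve-∀

  record Spectrum (α s s₂ : ℕ) : Set where
    field
      s+s₂≡N   : s + s₂ ≡ N
      s*s₂≡α*n′ : s * s₂ ≡ α * n′
      F*α≡N*D  : F * α ≡ N * D

  record SpectralRoot (s b v r k lam lam₁ lam₂ : ℕ) : Set where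
    field
      b≡B         : b ≡ B
      v≡F         : v ≡ F
      r≡M*s       : r ≡ M * s
      lam+D≡r     : lam + D ≡ r
      N*k≡s*F     : N * k ≡ s * F
      k≡lam₁+D    : k ≡ lam₁ + D
      lam₂≡lam₁+μ : lam₂ ≡ lam₁ + μ

    lam+D≡M*s : lam + D ≡ M * s
    lam+D≡M*s = trans lam+D≡r r≡M*s

  instance
    F-nonZero : NonZero F
    F-nonZero = subst NonZero (ℕ.+-comm 1 (M * n′)) _
    B-nonZero : NonZero B
    B-nonZero = subst NonZero M*N≡B _

  spectrum-comm : ∀ {α s s₂} → Spectrum α s s₂ → Spectrum α s₂ s
  spectrum-comm {s = s} {s₂} S = record
    { s+s₂≡N = trans (ℕ.+-comm s₂ s) s+s₂≡N
    ; s*s₂≡α*n′ = trans (ℕ.*-comm s₂ s) s*s₂≡α*n′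
    ; F*α≡N*D = F*α≡N*D
    }
    where open Spectrum S

  s*s₂*F≡n′*[N*D] : ∀ {α s s₂} → Spectrum α s s₂ → s * s₂ * F ≡ n′ * (N * D)
  s*s₂*F≡n′*[N*D] {α} {s} {s₂} S = begin
    s * s₂ * F      ≡⟨ cong (_* F) s*s₂≡α*n′ ⟩
    α * n′ * F      ≡⟨ ring α n′ F ⟩
    n′ * (F * α)    ≡⟨ cong (n′ *_) F*α≡N*D ⟩
    n′ * (N * D)    ∎
    where
    open ≡-Reasoning
    open Spectrum S
    ring : ∀ a b c → a * b * c ≡ b * (c * a)
    ring = solve-∀

  paramsFrom-of-spectral : ∀ {s b v r k lam lam₁ lam₂} →
    SpectralRoot s b v r k lam lam₁ lam₂ → ParamsFromℕ b v r k lam lam₁ lam₂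
  paramsFrom-of-spectral {s} {k = k} {lam} {lam₁} R =
    record
      { b≡B = b≡B ; v≡F = v≡F ; r≡lam+D = sym lam+D≡r
      ; B*lam₁+g*D≡F*lam = ℕ.+-cancelʳ-≡ (F * D) _ _ lam₁-eq
      ; lam₂≡lam₁+μ = lam₂≡lam₁+μ ; k≡lam₁+D = k≡lam₁+D }
    where
    open ≡-Reasoning
    open SpectralRoot R
    ring : ∀ a b l d → (suc a * b + a + 1) * l + a * d + (suc a * b + 1) * d ≡ suc a * (suc b * (l + d))
    ring = solve-∀
    ring′ : ∀ a b c → a * (b * c) ≡ c * (a * b)
    ring′ = solve-∀
    lam₁-eq : B * lam₁ + m′ * D + F * D ≡ F * lam + F * D
    lam₁-eq = begin
      B * lam₁ + m′ * D + F * D ≡⟨ ring m′ n′ lam₁ D ⟩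
      M * (N * (lam₁ + D))      ≡⟨ cong (λ x → M * (N * x)) (sym k≡lam₁+D) ⟩
      M * (N * k)               ≡⟨ cong (M *_) N*k≡s*F ⟩
      M * (s * F)               ≡⟨ ring′ M s F ⟩
      F * (M * s)               ≡⟨ cong (F *_) (sym lam+D≡M*s) ⟩
      F * (lam + D)             ≡⟨ ℕ.*-distribˡ-+ F lam D ⟩
      F * lam + F * D           ∎

  r*k+lam≡r+lam*F : ∀ {α s s₂ b v r k lam lam₁ lam₂} → Spectrum α s s₂ →
    SpectralRoot s b v r k lam lam₁ lam₂ → r * k + lam ≡ r + lam * F
  r*k+lam≡r+lam*F {α} {s} {s₂} {r = r} {k} {lam} S R =
    ℕ.*-cancelˡ-≡ _ _ N (ℕ.+-cancelʳ-≡ (r * s₂ * F) _ _ (begin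
      N * (r * k + lam) + r * s₂ * F        ≡⟨ ring₁ N r k lam (r * s₂ * F) ⟩
      r * (N * k) + N * lam + r * s₂ * F    ≡⟨ cong (λ x → r * x + N * lam + r * s₂ * F) N*k≡s*F ⟩
      r * (s * F) + N * lam + r * s₂ * F    ≡⟨ ring₂ r s s₂ F (N * lam) ⟩
      r * F * (s + s₂) + N * lam            ≡⟨ cong (λ x → r * F * x + N * lam) (Spectrum.s+s₂≡N S) ⟩
      r * F * N + N * lam                   ≡⟨ cong (λ x → x * F * N + N * lam) (sym lam+D≡r) ⟩
      (lam + D) * F * N + N * lam           ≡⟨ ring₃ m′ n′ lam D ⟩
      N * lam + N * lam * F + N * D + M * (n′ * (N * D))
        ≡⟨ cong (λ x → N * lam + N * lam * F + N * D + M * x) (sym (s*s₂*F≡n′*[N*D] S)) ⟩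
      N * lam + N * lam * F + N * D + M * (s * s₂ * F) ≡⟨ ring₄ N lam F D M s s₂ ⟩
      N * (lam + D) + N * (lam * F) + M * s * s₂ * F
        ≡⟨ cong₂ (λ x y → N * x + N * (lam * F) + y * s₂ * F) lam+D≡r (sym r≡M*s) ⟩
      N * r + N * (lam * F) + r * s₂ * F    ≡⟨ ring₅ N r lam F (r * s₂ * F) ⟩
      N * (r + lam * F) + r * s₂ * F        ∎))
    where
    open ≡-Reasoning
    open SpectralRoot R
    ring₁ : ∀ n r k l c → n * (r * k + l) + c ≡ r * (n * k) + n * l + c
    ring₁ = solve-∀
    ring₂ : ∀ r s s₂ f c → r * (s * f) + c + r * s₂ * f ≡ r * f * (s + s₂) + c
    ring₂ = solve-∀
    ring₃ : ∀ a b l d → (l + d) * (suc a * b + 1) * suc b + suc b * l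
                      ≡ suc b * l + suc b * l * (suc a * b + 1) + suc b * d + suc a * (b * (suc b * d))
    ring₃ = solve-∀
    ring₄ : ∀ n l f d m s s₂ → n * l + n * l * f + n * d + m * (s * s₂ * f)
                             ≡ n * (l + d) + n * (l * f) + m * s * s₂ * f
    ring₄ = solve-∀
    ring₅ : ∀ n r l f c → n * r + n * (l * f) + c ≡ n * (r + l * f) + c
    ring₅ = solve-∀

  designEqs-of-spectral : ∀ {α s s₂ b v r k lam lam₁ lam₂} → Spectrum α s s₂ →
    SpectralRoot s b v r k lam lam₁ lam₂ → DesignEqsℕ b v r k lam
  designEqs-of-spectral {s = s} {b = b} {v} {r} {k} {lam} S R = record
    { b*k≡r*v = begin
        b * k         ≡⟨ cong (_* k) (trans b≡B (sym M*N≡B)) ⟩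
        M * N * k     ≡⟨ ℕ.*-assoc M N k ⟩
        M * (N * k)   ≡⟨ cong (M *_) N*k≡s*F ⟩
        M * (s * F)   ≡⟨ sym (ℕ.*-assoc M s F) ⟩
        M * s * F     ≡⟨ cong₂ _*_ (sym r≡M*s) (sym v≡F) ⟩
        r * v         ∎
    ; r*k+lam≡r+lam*v = trans (r*k+lam≡r+lam*F S R) (cong (λ x → r + lam * x) (sym v≡F))
    }
    where
    open ≡-Reasoning
    open SpectralRoot R

  vietaSum⇔ : ∀ x y {s s₂} → x + D ≡ M * s → y + D ≡ M * s₂ → (x + y + 2 * D ≡ B) ⇔ (s + s₂ ≡ N)
  vietaSum⇔ x y {s} {s₂} ex ey = mk⇔
    (λ e → ℕ.*-cancelˡ-≡ _ _ M (trans (sym expand) (trans e (sym M*N≡B))))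
    (λ e → trans expand (trans (cong (M *_) e) M*N≡B))
    where
    open ≡-Reasoning
    ring : ∀ x y d → x + y + 2 * d ≡ (x + d) + (y + d)
    ring = solve-∀
    expand : x + y + 2 * D ≡ M * (s + s₂)
    expand = begin
      x + y + 2 * D       ≡⟨ ring x y D ⟩
      (x + D) + (y + D)   ≡⟨ cong₂ _+_ ex ey ⟩
      M * s + M * s₂      ≡⟨ sym (ℕ.*-distribˡ-+ M s s₂) ⟩
      M * (s + s₂)        ∎

  vietaProduct⇔ : ∀ x y {s s₂} → x + y + 2 * D ≡ B → x + D ≡ M * s → y + D ≡ M * s₂ →
    (F * (x * y) + D * B ≡ F * (D * D)) ⇔ (s * s₂ * F ≡ n′ * (N * D))
  vietaProduct⇔ x y {s} {s₂} vs ex ey = mk⇔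
    (λ e → ℕ.*-cancelˡ-≡ _ _ (M * M) (ℕ.+-cancelʳ-≡ (F * (D * D)) _ _
       (trans (sym expand) (trans (cong (_+ c) e) expand′))))
    (λ e → ℕ.+-cancelʳ-≡ c _ _
       (trans expand (trans (cong (λ z → M * M * z + F * (D * D)) e) (sym expand′))))
    where
    open ≡-Reasoning
    c : ℕ
    c = M * n′ * D * B
    ring₁ : ∀ f p d b → (f + 1) * p + d * b + f * d * b ≡ (f + 1) * p + (f + 1) * d * b
    ring₁ = solve-∀
    ring₂ : ∀ f x y d → f * (x * y) + f * d * (x + y + 2 * d) ≡ f * ((x + d) * (y + d)) + f * (d * d)
    ring₂ = solve-∀
    ring₃ : ∀ m s s₂ f → f * ((m * s) * (m * s₂)) ≡ m * m * (s * s₂ * f)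
    ring₃ = solve-∀
    ring₄ : ∀ f d m a n → f * (d * d) + m * a * d * (m * n) ≡ m * m * (a * (n * d)) + f * (d * d)
    ring₄ = solve-∀
    expand : F * (x * y) + D * B + c ≡ M * M * (s * s₂ * F) + F * (D * D)
    expand = begin
      F * (x * y) + D * B + c                    ≡⟨ ring₁ (M * n′) (x * y) D B ⟩
      F * (x * y) + F * D * B                    ≡⟨ cong (λ z → F * (x * y) + F * D * z) (sym vs) ⟩
      F * (x * y) + F * D * (x + y + 2 * D)      ≡⟨ ring₂ F x y D ⟩
      F * ((x + D) * (y + D)) + F * (D * D)      ≡⟨ cong₂ (λ u w → F * (u * w) + F * (D * D)) ex ey ⟩
      F * ((M * s) * (M * s₂)) + F * (D * D)     ≡⟨ cong (_+ F * (D * D)) (ring₃ M s s₂ F) ⟩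
      M * M * (s * s₂ * F) + F * (D * D)         ∎
    expand′ : F * (D * D) + c ≡ M * M * (n′ * (N * D)) + F * (D * D)
    expand′ = begin
      F * (D * D) + M * n′ * D * B               ≡⟨ cong (λ z → F * (D * D) + M * n′ * D * z) (sym M*N≡B) ⟩
      F * (D * D) + M * n′ * D * (M * N)         ≡⟨ ring₄ F D M n′ N ⟩
      M * M * (n′ * (N * D)) + F * (D * D)       ∎

  design⇒r≡M*s : ∀ z {k} → B * k ≡ (z + D) * F → Σ ℕ λ s → (z + D ≡ M * s) × (N * k ≡ s * F)
  design⇒r≡M*s z {k} e = part (coprime-divisor (∣⇒coprime-+1 (m∣m*n n′)) M∣F*[z+D])
    where
    open ≡-Reasoning
    ring : ∀ a b c → a * b * c ≡ b * c * a
    ring = solve-∀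
    M∣F*[z+D] : M ∣ F * (z + D)
    M∣F*[z+D] = divides (N * k) (begin
      F * (z + D)  ≡⟨ ℕ.*-comm F (z + D) ⟩
      (z + D) * F  ≡⟨ sym e ⟩
      B * k        ≡⟨ cong (_* k) (sym M*N≡B) ⟩
      M * N * k    ≡⟨ ring M N k ⟩
      N * k * M    ∎)
    part : M ∣ z + D → Σ ℕ λ s → (z + D ≡ M * s) × (N * k ≡ s * F)
    part (divides s z+D≡s*M) = s , z+D≡M*s , ℕ.*-cancelˡ-≡ _ _ M (begin
      M * (N * k)    ≡⟨ sym (ℕ.*-assoc M N k) ⟩
      M * N * k      ≡⟨ cong (_* k) M*N≡B ⟩
      B * k          ≡⟨ e ⟩
      (z + D) * F    ≡⟨ cong (_* F) z+D≡M*s ⟩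
      M * s * F      ≡⟨ ℕ.*-assoc M s F ⟩
      M * (s * F)    ∎)
      where
      z+D≡M*s : z + D ≡ M * s
      z+D≡M*s = trans z+D≡s*M (ℕ.*-comm s M)

  spectrum-of-roots : ∀ {x y s s₂} → .{{NonZero n′}} → Vieta x y →
    x + D ≡ M * s → y + D ≡ M * s₂ → Σ ℕ λ α → Spectrum α s s₂
  spectrum-of-roots {x} {y} {s} {s₂} V ex ey =
    spectrum (coprime-divisor (∣⇒coprime-+1 (n∣m*n M)) n′∣F*[s*s₂])
    where
    open ≡-Reasoning
    s*s₂*F≡ : s * s₂ * F ≡ n′ * (N * D)
    s*s₂*F≡ = Equivalence.to (vietaProduct⇔ x y (Vieta.sum V) ex ey) (Vieta.product V)
    n′∣F*[s*s₂] : n′ ∣ F * (s * s₂)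
    n′∣F*[s*s₂] = divides (N * D) (trans (ℕ.*-comm F (s * s₂)) (trans s*s₂*F≡ (ℕ.*-comm n′ (N * D))))
    ring : ∀ a f b → a * (f * b) ≡ b * a * f
    ring = solve-∀
    spectrum : n′ ∣ s * s₂ → Σ ℕ λ α → Spectrum α s s₂
    spectrum (divides α s*s₂≡α*n′) = α , record
      { s+s₂≡N = Equivalence.to (vietaSum⇔ x y ex ey) (Vieta.sum V)
      ; s*s₂≡α*n′ = s*s₂≡α*n′
      ; F*α≡N*D = ℕ.*-cancelˡ-≡ _ _ n′ (begin
          n′ * (F * α)   ≡⟨ ring n′ F α ⟩
          α * n′ * F     ≡⟨ cong (_* F) (sym s*s₂≡α*n′) ⟩
          s * s₂ * F     ≡⟨ s*s₂*F≡ ⟩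
          n′ * (N * D)   ∎)
      }

  α≤s : ∀ {α s s₂ k} → Spectrum α s s₂ → N * k ≡ s * F → D ≤ k → α ≤ s
  α≤s {α} {s} {k = k} S N*k≡s*F D≤k = ℕ.*-cancelʳ-≤ α s F (begin
    α * F   ≡⟨ ℕ.*-comm α F ⟩
    F * α   ≡⟨ Spectrum.F*α≡N*D S ⟩
    N * D   ≤⟨ ℕ.*-monoʳ-≤ N D≤k ⟩
    N * k   ≡⟨ N*k≡s*F ⟩
    s * F   ∎)
    where open ℕ.≤-Reasoning

  goodRoot-design : ∀ {b v r k z lam₁ lam₂} → ParamsFromℕ b v r k z lam₁ lam₂ → GoodRootℕ z →
    B * k ≡ (z + D) * F
  goodRoot-design {k = k} {z} {lam₁} P (b′ , v′ , r′ , k′ , lam₁′ , _ , P′ , E′) = begin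
    B * k             ≡⟨ cong (B *_) (trans k≡lam₁+D (trans (cong (_+ D) lam₁≡lam₁′) (sym (Q.k≡lam₁+D)))) ⟩
    B * k′            ≡⟨ cong (_* k′) (sym Q.b≡B) ⟩
    b′ * k′           ≡⟨ DesignEqsℕ.b*k≡r*v E′ ⟩
    r′ * v′           ≡⟨ cong₂ _*_ Q.r≡lam+D Q.v≡F ⟩
    (z + D) * F       ∎
    where
    open ≡-Reasoning
    open ParamsFromℕ P
    module Q = ParamsFromℕ P′
    lam₁≡lam₁′ : lam₁ ≡ lam₁′
    lam₁≡lam₁′ = ℕ.*-cancelˡ-≡ _ _ B
      (ℕ.+-cancelʳ-≡ (m′ * D) _ _ (trans B*lam₁+g*D≡F*lam (sym Q.B*lam₁+g*D≡F*lam)))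

  vieta-comm : ∀ {x y} → Vieta x y → Vieta y x
  vieta-comm {x} {y} V = record
    { sum = trans (cong (_+ 2 * D) (ℕ.+-comm y x)) (Vieta.sum V)
    ; product = trans (cong (λ z → F * z + D * B) (ℕ.*-comm y x)) (Vieta.product V)
    }

  vieta-of-spectrum : ∀ {α s s₂ x y} → Spectrum α s s₂ → x + D ≡ M * s → y + D ≡ M * s₂ → Vieta x y
  vieta-of-spectrum {x = x} {y} S ex ey = record
    { sum = sum
    ; product = Equivalence.from (vietaProduct⇔ x y sum ex ey) (s*s₂*F≡n′*[N*D] S)
    }
    where
    sum : x + y + 2 * D ≡ B
    sum = Equivalence.from (vietaSum⇔ x y ex ey) (Spectrum.s+s₂≡N S)

  partner : Feasibleℕ → ∀ lam → IsRoot (M * n′) m′ (+ 0) σ μ (+ lam) →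
    Σ ℕ λ y → Vieta lam y × GoodRootℕ lam × GoodRootℕ y
  partner (x , y , V , gx , gy) lam isRoot with Equivalence.to (isRoot⇔ lam V) isRoot
  ... | inj₁ refl = y , V , gx , gy
  ... | inj₂ refl = x , vieta-comm V , gy , gx

  goodRoot-of-spectral : ∀ {α s s₂ b v r k lam lam₁ lam₂} → Spectrum α s s₂ →
    SpectralRoot s b v r k lam lam₁ lam₂ → GoodRootℕ lam
  goodRoot-of-spectral {b = b} {v} {r} {k} {lam₁ = lam₁} {lam₂} S R =
    b , v , r , k , lam₁ , lam₂ , paramsFrom-of-spectral R , designEqs-of-spectral S R

  srd-of-spectral : ∀ {α s s₂ b v r k lam lam₁ lam₂ b′ v′ r′ k′ lam′ lam₁′ lam₂′} →
    1 ≤ m′ → 1 ≤ n′ → 1 ≤ μ → Spectrum α s s₂ →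
    SpectralRoot s b v r k lam lam₁ lam₂ → SpectralRoot s₂ b′ v′ r′ k′ lam′ lam₁′ lam₂′ →
    FeasibleSRD (params M N μ b v r k lam lam₁ lam₂)
  srd-of-spectral {lam = lam} {lam′ = lam′} m′≥1 n′≥1 μ≥1 S R R′ =
    s≤s m′≥1 , s≤s n′≥1 , μ≥1 ,
    Equivalence.from feasible⇔
      (lam , lam′ , V , goodRoot-of-spectral S R , goodRoot-of-spectral (spectrum-comm S) R′) ,
    Equivalence.from (isRoot⇔ lam V) (inj₁ refl) ,
    Equivalence.from (paramsFrom⇔ _ _ _ _ _ _ _) (paramsFrom-of-spectral R)
    where
    V : Vieta lam lam′
    V = vieta-of-spectrum S (SpectralRoot.lam+D≡M*s R) (SpectralRoot.lam+D≡M*s R′)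

  spectral-of-srd : ∀ {b v r k lam lam₁ lam₂} → FeasibleSRD (params M N μ b v r k lam lam₁ lam₂) →
    Σ ℕ λ α → Σ ℕ λ s → Σ ℕ λ s₂ →
      Spectrum α s s₂ × α ≤ s × α ≤ s₂ × SpectralRoot s b v r k lam lam₁ lam₂
  spectral-of-srd {b} {v} {r} {k} {lam} {lam₁} {lam₂} (_ , s≤s n′≥1 , _ , feasible , isRoot , pf) =
    spectral (partner (Equivalence.to feasible⇔ feasible) lam isRoot)
    where
    instance
      n′-nonZero : NonZero n′
      n′-nonZero = >-nonZero n′≥1
    P : ParamsFromℕ b v r k lam lam₁ lam₂
    P = Equivalence.to (paramsFrom⇔ b v r k lam lam₁ lam₂) pf
    open ParamsFromℕ P
    spectral : (Σ ℕ λ y → Vieta lam y × GoodRootℕ lam × GoodRootℕ y) →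
      Σ ℕ λ α → Σ ℕ λ s → Σ ℕ λ s₂ →
        Spectrum α s s₂ × α ≤ s × α ≤ s₂ × SpectralRoot s b v r k lam lam₁ lam₂
    spectral (y , V , glam , gy@(_ , _ , _ , _ , _ , _ , P′ , _)) =
      let (s , ex , eN) = design⇒r≡M*s lam (goodRoot-design P glam)
          (s₂ , ey , eN′) = design⇒r≡M*s y (goodRoot-design P′ gy)
          (α , S) = spectrum-of-roots V ex ey
      in α , s , s₂ , S , α≤s S eN D≤k , α≤s (spectrum-comm S) eN′ (ParamsFromℕ.D≤k P′) , record
        { b≡B = b≡B ; v≡F = v≡F ; r≡M*s = trans r≡lam+D ex ; lam+D≡r = sym r≡lam+D
        ; N*k≡s*F = eN ; k≡lam₁+D = k≡lam₁+D ; lam₂≡lam₁+μ = lam₂≡lam₁+μ }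

-- Admissible quadruples

module _ (a l l* : ℕ) (l*l*≡ : l * l* ≡ suc a * a) where

  admissible-product : (suc a + l) * (suc a + l*) ≡ suc a * (l + l* + 2 * a + 1)
  admissible-product = begin
    (suc a + l) * (suc a + l*)                 ≡⟨ ring₁ a l l* ⟩
    suc a * (suc a + l + l*) + l * l*          ≡⟨ cong (_+_ (suc a * (suc a + l + l*))) l*l*≡ ⟩
    suc a * (suc a + l + l*) + suc a * a       ≡⟨ ring₂ a l l* ⟩
    suc a * (l + l* + 2 * a + 1)               ∎
    where
    open ≡-Reasoning
    ring₁ : ∀ a l l* → (suc a + l) * (suc a + l*) ≡ suc a * (suc a + l + l*) + l * l*
    ring₁ = solve-∀
    ring₂ : ∀ a l l* → suc a * (suc a + l + l*) + suc a * a ≡ suc a * (l + l* + 2 * a + 1)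
    ring₂ = solve-∀

  admissible-square : (suc a + l) * (suc a + l) ≡ (l + l* + 2 * suc a) * l + suc a
  admissible-square = begin
    (suc a + l) * (suc a + l)                  ≡⟨ ring₁ a l ⟩
    l * (l + 2 * suc a) + suc a * a + suc a    ≡⟨ cong (λ z → l * (l + 2 * suc a) + z + suc a) (sym l*l*≡) ⟩
    l * (l + 2 * suc a) + l * l* + suc a       ≡⟨ ring₂ a l l* ⟩
    (l + l* + 2 * suc a) * l + suc a           ∎
    where
    open ≡-Reasoning
    ring₁ : ∀ a l → (suc a + l) * (suc a + l) ≡ l * (l + 2 * suc a) + suc a * a + suc a
    ring₁ = solve-∀
    ring₂ : ∀ a l l* → l * (l + 2 * suc a) + l * l* + suc a ≡ (l + l* + 2 * suc a) * l + suc a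
    ring₂ = solve-∀

n≡suc[n∸1] : ∀ a l l* → l + l* + 2 * suc a ≡ suc (l + l* + 2 * a + 1)
n≡suc[n∸1] = solve-∀

-- p is the parameter set assigned to (α, l, l*, t), with the divisions by α multiplied out.
record Realizes (α l l* t : ℕ) (p : Params) : Set where
  field
    n≡       : n p ≡ l + l* + 2 * α
    α*m≡     : α * m p ≡ t * (n p * n p) + α * (n p + 1)
    μ≡       : μ p ≡ (n p ∸ 1) * t + α
    b≡       : b p ≡ m p * n p
    α*v≡     : α * v p ≡ n p * n p * μ p
    r≡       : r p ≡ m p * (α + l)
    α*k≡     : α * k p ≡ n p * μ p * (α + l)
    lam+nμ≡r : lam p + n p * μ p ≡ r p
    α*lam₁≡  : α * lam₁ p ≡ n p * μ p * l
    lam₂≡    : lam₂ p ≡ lam₁ p + μ p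

params-cong : ∀ {m n μ b v r k lam lam₁ lam₂ m′ n′ μ′ b′ v′ r′ k′ lam′ lam₁′ lam₂′} →
  m ≡ m′ → n ≡ n′ → μ ≡ μ′ → b ≡ b′ → v ≡ v′ → r ≡ r′ → k ≡ k′ → lam ≡ lam′ → lam₁ ≡ lam₁′ → lam₂ ≡ lam₂′ →
  params m n μ b v r k lam lam₁ lam₂ ≡ params m′ n′ μ′ b′ v′ r′ k′ lam′ lam₁′ lam₂′
params-cong refl refl refl refl refl refl refl refl refl refl = refl

realizes-unique : ∀ {a l l* t p p′} → Realizes (suc a) l l* t p → Realizes (suc a) l l* t p′ → p ≡ p′
realizes-unique {a} {l} {l*} {t} {p} {p′} R R′ =
  params-cong em en eμ eb ev er ek elam elam₁ elam₂
  where
  module R = Realizes R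
  module R′ = Realizes R′
  α : ℕ
  α = suc a
  α*-unique : ∀ {x y u w} → α * x ≡ u → α * y ≡ w → u ≡ w → x ≡ y
  α*-unique ex ey e = ℕ.*-cancelˡ-≡ _ _ α (trans ex (trans e (sym ey)))
  en : n p ≡ n p′
  en = trans R.n≡ (sym R′.n≡)
  em : m p ≡ m p′
  em = α*-unique R.α*m≡ R′.α*m≡ (cong (λ z → t * (z * z) + α * (z + 1)) en)
  eμ : μ p ≡ μ p′
  eμ = trans R.μ≡ (trans (cong (λ z → (z ∸ 1) * t + α) en) (sym R′.μ≡))
  eb : b p ≡ b p′
  eb = trans R.b≡ (trans (cong₂ _*_ em en) (sym R′.b≡))
  ev : v p ≡ v p′
  ev = α*-unique R.α*v≡ R′.α*v≡ (cong₂ (λ x y → x * x * y) en eμ)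
  er : r p ≡ r p′
  er = trans R.r≡ (trans (cong (_* (α + l)) em) (sym R′.r≡))
  ek : k p ≡ k p′
  ek = α*-unique R.α*k≡ R′.α*k≡ (cong₂ (λ x y → x * y * (α + l)) en eμ)
  elam : lam p ≡ lam p′
  elam = ℕ.+-cancelʳ-≡ _ _ _
    (trans (cong₂ (λ x y → lam p + x * y) (sym en) (sym eμ)) (trans R.lam+nμ≡r (trans er (sym R′.lam+nμ≡r))))
  elam₁ : lam₁ p ≡ lam₁ p′
  elam₁ = α*-unique R.α*lam₁≡ R′.α*lam₁≡ (cong₂ (λ x y → x * y * l) en eμ)
  elam₂ : lam₂ p ≡ lam₂ p′
  elam₂ = trans R.lam₂≡ (trans (cong₂ _+_ elam₁ eμ) (sym R′.lam₂≡))

admissible⇒∣t*l*l : ∀ a l l* t → l * l* ≡ suc a * a → suc a ∣ (l + l*) ^ 2 * t → suc a ∣ t * (l * l)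
admissible⇒∣t*l*l a l l* t l*l*≡ α∣[l+l*]²t = d∣x+y⇒d*d∣x*y⇒d∣x (suc a) ∣sum ∣product
  where
  open ≡-Reasoning
  ring₁ : ∀ l l* t → (l + l*) * ((l + l*) * 1) * t ≡ 2 * t * (l * l*) + (t * (l * l) + t * (l* * l*))
  ring₁ = solve-∀
  ∣sum : suc a ∣ t * (l * l) + t * (l* * l*)
  ∣sum = ∣m+n∣m⇒∣n (subst (suc a ∣_) (ring₁ l l* t) α∣[l+l*]²t)
    (∣n⇒∣m*n (2 * t) (divides a (trans l*l*≡ (ℕ.*-comm (suc a) a))))
  ring₂ : ∀ t l l* → t * (l * l) * (t * (l* * l*)) ≡ t * t * ((l * l*) * (l * l*))
  ring₂ = solve-∀
  ring₃ : ∀ t α a → t * t * ((α * a) * (α * a)) ≡ t * t * a * a * (α * α)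
  ring₃ = solve-∀
  ∣product : suc a * suc a ∣ t * (l * l) * (t * (l* * l*))
  ∣product = divides (t * t * a * a) (begin
    t * (l * l) * (t * (l* * l*))       ≡⟨ ring₂ t l l* ⟩
    t * t * ((l * l*) * (l * l*))       ≡⟨ cong (λ z → t * t * (z * z)) l*l*≡ ⟩
    t * t * ((suc a * a) * (suc a * a)) ≡⟨ ring₃ t (suc a) a ⟩
    t * t * a * a * (suc a * suc a)     ∎)

admissible⇒∣t*l*n : ∀ a l l* t → l * l* ≡ suc a * a → suc a ∣ (l + l*) ^ 2 * t →
  suc a ∣ t * l * (l + l* + 2 * suc a)
admissible⇒∣t*l*n a l l* t l*l*≡ α∣[l+l*]²t = ∣-affine 1 (2 * t * l)
  (∣m∣n⇒∣m+n (admissible⇒∣t*l*l a l l* t l*l*≡ α∣[l+l*]²t) (∣n⇒∣m*n t (divides a (trans l*l*≡ (ℕ.*-comm (suc a) a)))))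
  (ring a l l* t)
  where
  ring : ∀ a l l* t → t * l * (l + l* + 2 * suc a) ≡ 1 * (t * (l * l) + t * (l * l*)) + suc a * (2 * t * l)
  ring = solve-∀

module _ (a l l* t : ℕ) (l*l*≡ : l * l* ≡ suc a * a) (α∣[l+l*]²t : suc a ∣ (l + l*) ^ 2 * t) where

  private
    α N n′ μ₀ : ℕ
    α = suc a
    N = l + l* + 2 * α
    n′ = l + l* + 2 * a + 1
    μ₀ = (N ∸ 1) * t + α

    μ₀≡ : μ₀ ≡ n′ * t + α
    μ₀≡ = cong (λ z → (z ∸ 1) * t + α) (n≡suc[n∸1] a l l*)

    square : (α + l) * (α + l) ≡ N * l + α
    square = admissible-square a l l* l*l*≡

    exact : ∀ {x} → α ∣ x → α * divα x α ≡ x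
    exact = m*[n/m]≡n

    α∣t*l*N : α ∣ t * l * N
    α∣t*l*N = admissible⇒∣t*l*n a l l* t l*l*≡ α∣[l+l*]²t

    α∣t*l**N : α ∣ t * l* * N
    α∣t*l**N = subst (λ z → α ∣ t * l* * (z + 2 * α)) (ℕ.+-comm l* l)
      (admissible⇒∣t*l*n a l* l t (trans (ℕ.*-comm l* l) l*l*≡)
        (subst (λ z → α ∣ z ^ 2 * t) (ℕ.+-comm l l*) α∣[l+l*]²t))

    α∣t*N*N : α ∣ t * (N * N)
    α∣t*N*N = ∣-affine 1 _ α∣[l+l*]²t (ring t (l + l*) α)
      where
      ring : ∀ t L α → t * ((L + 2 * α) * (L + 2 * α)) ≡ 1 * (L * (L * 1) * t) + α * (4 * t * (L + α))
      ring = solve-∀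

    α∣N*μ*x : ∀ x → α ∣ t * x * N → α ∣ N * μ₀ * x
    α∣N*μ*x x α∣t*x*N = subst (λ z → α ∣ N * z * x) (sym μ₀≡) (∣-affine n′ (N * x) α∣t*x*N (ring N n′ t α x))
      where
      ring : ∀ N n′ t α x → N * (n′ * t + α) * x ≡ n′ * (t * x * N) + α * (N * x)
      ring = solve-∀

    α∣N*μ*[α+x] : ∀ x → α ∣ t * x * N → α ∣ N * μ₀ * (α + x)
    α∣N*μ*[α+x] x α∣t*x*N = ∣-affine 1 _ (α∣N*μ*x x α∣t*x*N) (ring N μ₀ α x)
      where
      ring : ∀ N μ α x → N * μ * (α + x) ≡ 1 * (N * μ * x) + α * (N * μ)
      ring = solve-∀

    α∣N*N*μ : α ∣ N * N * μ₀
    α∣N*N*μ = subst (α ∣_) (sym (ring a l l* μ₀))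
      (∣m∣n⇒∣m+n (α∣N*μ*[α+x] l α∣t*l*N) (α∣N*μ*[α+x] l* α∣t*l**N))
      where
      ring : ∀ a l l* μ → (l + l* + 2 * suc a) * (l + l* + 2 * suc a) * μ
        ≡ (l + l* + 2 * suc a) * μ * (suc a + l) + (l + l* + 2 * suc a) * μ * (suc a + l*)
      ring = solve-∀

    α∣[t*N+α]*[α+l]² : α ∣ (t * N + α) * ((α + l) * (α + l))
    α∣[t*N+α]*[α+l]² = ∣-affine N _ α∣t*l*N (trans (cong ((t * N + α) *_) square) (ring α N t l))
      where
      ring : ∀ α N t l → (t * N + α) * (N * l + α) ≡ N * (t * l * N) + α * (t * N + N * l + α)
      ring = solve-∀

    α∣μ*[α+l]² : α ∣ μ₀ * ((α + l) * (α + l))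
    α∣μ*[α+l]² = ∣-affine 1 μ₀ (α∣N*μ*x l α∣t*l*N) (trans (cong (μ₀ *_) square) (ring α N μ₀ l))
      where
      ring : ∀ α N μ l → μ * (N * l + α) ≡ 1 * (N * μ * l) + α * μ
      ring = solve-∀

    M : ℕ
    M = divα (t * (N * N)) α + N + 1

    α*M≡ : α * M ≡ t * (N * N) + α * (N + 1)
    α*M≡ = trans (ring α (divα (t * (N * N)) α) N) (cong (_+ α * (N + 1)) (exact α∣t*N*N))
      where
      ring : ∀ α y N → α * (y + N + 1) ≡ α * y + α * (N + 1)
      ring = solve-∀

    lam+N*μ≡M*[α+l] : divα ((t * N + α) * ((α + l) * (α + l))) α + l + N * μ₀ ≡ M * (α + l)
    lam+N*μ≡M*[α+l] = ℕ.*-cancelˡ-≡ _ _ α (begin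
      α * (divα ((t * N + α) * ((α + l) * (α + l))) α + l + N * μ₀)
        ≡⟨ ring₁ α _ l (N * μ₀) ⟩
      α * divα ((t * N + α) * ((α + l) * (α + l))) α + α * (l + N * μ₀)
        ≡⟨ cong₂ (λ x y → x + α * (l + N * y)) (exact α∣[t*N+α]*[α+l]²) μ₀≡ ⟩
      (t * N + α) * ((α + l) * (α + l)) + α * (l + N * (n′ * t + α))
        ≡⟨ cong (λ x → (t * N + α) * x + α * (l + N * (n′ * t + α))) square ⟩
      (t * N + α) * (N * l + α) + α * (l + N * (n′ * t + α))
        ≡⟨ cong (λ z → (t * z + α) * (z * l + α) + α * (l + z * (n′ * t + α))) (n≡suc[n∸1] a l l*) ⟩
      (t * suc n′ + α) * (suc n′ * l + α) + α * (l + suc n′ * (n′ * t + α))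
        ≡⟨ ring₂ n′ t α l ⟩
      (t * (suc n′ * suc n′) + α * (suc n′ + 1)) * (α + l)
        ≡⟨ cong (λ z → (t * (z * z) + α * (z + 1)) * (α + l)) (sym (n≡suc[n∸1] a l l*)) ⟩
      (t * (N * N) + α * (N + 1)) * (α + l)
        ≡⟨ cong (_* (α + l)) (sym α*M≡) ⟩
      α * M * (α + l)
        ≡⟨ ℕ.*-assoc α M (α + l) ⟩
      α * (M * (α + l))  ∎)
      where
      open ≡-Reasoning
      ring₁ : ∀ α x l y → α * (x + l + y) ≡ α * x + α * (l + y)
      ring₁ = solve-∀
      ring₂ : ∀ n′ t α l → (t * suc n′ + α) * (suc n′ * l + α) + α * (l + suc n′ * (n′ * t + α))
                         ≡ (t * (suc n′ * suc n′) + α * (suc n′ + 1)) * (α + l)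
      ring₂ = solve-∀

    lam₂≡lam₁+μ : divα (μ₀ * ((α + l) * (α + l))) α ≡ divα (N * μ₀ * l) α + μ₀
    lam₂≡lam₁+μ = ℕ.*-cancelˡ-≡ _ _ α (begin
      α * divα (μ₀ * ((α + l) * (α + l))) α     ≡⟨ exact α∣μ*[α+l]² ⟩
      μ₀ * ((α + l) * (α + l))                   ≡⟨ cong (μ₀ *_) square ⟩
      μ₀ * (N * l + α)                           ≡⟨ ring α N μ₀ l ⟩
      N * μ₀ * l + α * μ₀                        ≡⟨ cong (_+ α * μ₀) (sym (exact (α∣N*μ*x l α∣t*l*N))) ⟩
      α * divα (N * μ₀ * l) α + α * μ₀           ≡⟨ sym (ℕ.*-distribˡ-+ α (divα (N * μ₀ * l) α) μ₀) ⟩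
      α * (divα (N * μ₀ * l) α + μ₀)             ∎)
      where
      open ≡-Reasoning
      ring : ∀ α N μ l → μ * (N * l + α) ≡ N * μ * l + α * μ
      ring = solve-∀

  assign-realizes : Realizes α l l* t (assign (α , l , l* , t))
  assign-realizes = record
    { n≡ = refl ; α*m≡ = α*M≡ ; μ≡ = refl ; b≡ = refl ; α*v≡ = exact α∣N*N*μ ; r≡ = refl
    ; α*k≡ = exact (α∣N*μ*[α+x] l α∣t*l*N) ; lam+nμ≡r = lam+N*μ≡M*[α+l]
    ; α*lam₁≡ = exact (α∣N*μ*x l α∣t*l*N) ; lam₂≡ = lam₂≡lam₁+μ }

module _ (m′ n′ μ : ℕ) where

  open Multipartite m′ n′ μ

  F*α≡ : ∀ α → F * α ≡ n′ * (α * M) + α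
  F*α≡ α = ring m′ n′ α
    where
    ring : ∀ a b α → (suc a * b + 1) * α ≡ b * (α * suc a) + α
    ring = solve-∀

  N*D≡ : ∀ t α → μ ≡ n′ * t + α → N * D ≡ n′ * (t * (N * N) + α * (N + 1)) + α
  N*D≡ t α μ≡ = trans (cong (λ z → N * (N * z)) μ≡) (ring n′ t α)
    where
    ring : ∀ b t α → suc b * (suc b * (b * t + α)) ≡ b * (t * (suc b * suc b) + α * (suc b + 1)) + α
    ring = solve-∀

  module _ {α : ℕ} .{{_ : NonZero α}} (F*α≡N*D : F * α ≡ N * D) where

    α*v≡N*N*μ⇔v≡F : ∀ {v} → (α * v ≡ N * N * μ) ⇔ (v ≡ F)
    α*v≡N*N*μ⇔v≡F {v} = mk⇔
      (λ e → ℕ.*-cancelˡ-≡ _ _ α (trans e α*F≡))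
      (λ e → trans (cong (α *_) e) (sym α*F≡))
      where
      α*F≡ : N * N * μ ≡ α * F
      α*F≡ = trans (ℕ.*-assoc N N μ) (trans (sym F*α≡N*D) (ℕ.*-comm F α))

    α*k≡N*μ*s⇔N*k≡s*F : ∀ {s k} → (α * k ≡ N * μ * s) ⇔ (N * k ≡ s * F)
    α*k≡N*μ*s⇔N*k≡s*F {s} {k} = mk⇔
      (λ e → ℕ.*-cancelˡ-≡ _ _ α (begin
        α * (N * k)       ≡⟨ ring₁ α N k ⟩
        N * (α * k)       ≡⟨ cong (N *_) e ⟩
        N * (N * μ * s)   ≡⟨ N*N*μ*s≡ ⟩
        α * (s * F)       ∎))
      (λ e → ℕ.*-cancelˡ-≡ _ _ N (begin
        N * (α * k)       ≡⟨ sym (ring₁ α N k) ⟩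
        α * (N * k)       ≡⟨ cong (α *_) e ⟩
        α * (s * F)       ≡⟨ sym N*N*μ*s≡ ⟩
        N * (N * μ * s)   ∎))
      where
      open ≡-Reasoning
      ring₁ : ∀ α N k → α * (N * k) ≡ N * (α * k)
      ring₁ = solve-∀
      ring₂ : ∀ N μ s → N * (N * μ * s) ≡ s * (N * (N * μ))
      ring₂ = solve-∀
      ring₃ : ∀ s f α → s * (f * α) ≡ α * (s * f)
      ring₃ = solve-∀
      N*N*μ*s≡ : N * (N * μ * s) ≡ α * (s * F)
      N*N*μ*s≡ = trans (ring₂ N μ s) (trans (cong (s *_) (sym F*α≡N*D)) (ring₃ s F α))

  α*lam₁≡N*μ*l⇔k≡lam₁+D : ∀ {α l k lam₁} .{{_ : NonZero α}} → α * k ≡ N * μ * (α + l) →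
    (α * lam₁ ≡ N * μ * l) ⇔ (k ≡ lam₁ + D)
  α*lam₁≡N*μ*l⇔k≡lam₁+D {α} {l} {k} {lam₁} α*k≡ = mk⇔
    (λ e → ℕ.*-cancelˡ-≡ _ _ α (trans α*k≡ (trans (ring α D l) (trans (cong (_+_ (α * D)) (sym e)) (ring′ α D lam₁)))))
    (λ e → ℕ.+-cancelʳ-≡ (α * D) _ _ (trans (sym (ℕ.*-distribˡ-+ α lam₁ D))
      (trans (cong (α *_) (sym e)) (trans α*k≡ (trans (ring α D l) (ℕ.+-comm (α * D) (D * l)))))))
    where
    ring : ∀ α d l → d * (α + l) ≡ α * d + d * l
    ring = solve-∀
    ring′ : ∀ α d x → α * d + α * x ≡ α * (x + d)
    ring′ = solve-∀

  module _ {a l l* t b v r k lam lam₁ lam₂ : ℕ} (l*l*≡ : l * l* ≡ suc a * a)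
           (R : Realizes (suc a) l l* t (params M N μ b v r k lam lam₁ lam₂)) where

    private
      open Realizes R
      F*α≡N*D : F * suc a ≡ N * D
      F*α≡N*D = begin
        F * suc a                                   ≡⟨ F*α≡ (suc a) ⟩
        n′ * (suc a * M) + suc a                    ≡⟨ cong (λ z → n′ * z + suc a) α*m≡ ⟩
        n′ * (t * (N * N) + suc a * (N + 1)) + suc a ≡⟨ sym (N*D≡ t (suc a) μ≡) ⟩
        N * D                                       ∎
        where open ≡-Reasoning

    spectrum-of-realizes : Spectrum (suc a) (suc a + l) (suc a + l*)
    spectrum-of-realizes = record
      { s+s₂≡N = trans (ring a l l*) (sym n≡)
      ; s*s₂≡α*n′ = trans (admissible-product a l l* l*l*≡)
          (cong (suc a *_) (sym (ℕ.suc-injective (trans n≡ (n≡suc[n∸1] a l l*)))))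
      ; F*α≡N*D = F*α≡N*D
      }
      where
      ring : ∀ a l l* → (suc a + l) + (suc a + l*) ≡ l + l* + 2 * suc a
      ring = solve-∀

    spectralRoot-of-realizes : SpectralRoot (suc a + l) b v r k lam lam₁ lam₂
    spectralRoot-of-realizes = record
      { b≡B = trans b≡ M*N≡B
      ; v≡F = Equivalence.to (α*v≡N*N*μ⇔v≡F F*α≡N*D) α*v≡
      ; r≡M*s = r≡
      ; lam+D≡r = lam+nμ≡r
      ; N*k≡s*F = Equivalence.to (α*k≡N*μ*s⇔N*k≡s*F F*α≡N*D) α*k≡
      ; k≡lam₁+D = Equivalence.to (α*lam₁≡N*μ*l⇔k≡lam₁+D α*k≡) α*lam₁≡
      ; lam₂≡lam₁+μ = lam₂≡
      }

  1≤N*D : 1 ≤ μ → 1 ≤ N * D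
  1≤N*D μ≥1 = ℕ.≤-trans μ≥1 (ℕ.≤-trans (ℕ.m≤n*m μ N) (ℕ.m≤n*m (N * μ) N))

  module _ {a l l* b v r k lam lam₁ lam₂ : ℕ} (S : Spectrum (suc a) (suc a + l) (suc a + l*))
           (R : SpectralRoot (suc a + l) b v r k lam lam₁ lam₂) where

    private
      open Spectrum S
      open SpectralRoot R
      α : ℕ
      α = suc a
      N≡ : N ≡ l + l* + 2 * α
      N≡ = trans (sym s+s₂≡N) (ring a l l*)
        where
        ring : ∀ a l l* → (suc a + l) + (suc a + l*) ≡ l + l* + 2 * suc a
        ring = solve-∀
      n′≡ : n′ ≡ l + l* + 2 * a + 1
      n′≡ = ℕ.suc-injective (trans N≡ (n≡suc[n∸1] a l l*))

    admissible-of-spectrum : l * l* ≡ suc a * a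
    admissible-of-spectrum = ℕ.+-cancelʳ-≡ (α * (α + l + l*)) _ _ (begin
      l * l* + α * (α + l + l*)    ≡⟨ ring₁ a l l* ⟩
      (α + l) * (α + l*)           ≡⟨ s*s₂≡α*n′ ⟩
      α * n′                       ≡⟨ cong (α *_) n′≡ ⟩
      α * (l + l* + 2 * a + 1)     ≡⟨ ring₂ a l l* ⟩
      α * a + α * (α + l + l*)     ∎)
      where
      open ≡-Reasoning
      ring₁ : ∀ a l l* → l * l* + suc a * (suc a + l + l*) ≡ (suc a + l) * (suc a + l*)
      ring₁ = solve-∀
      ring₂ : ∀ a l l* → suc a * (l + l* + 2 * a + 1) ≡ suc a * a + suc a * (suc a + l + l*)
      ring₂ = solve-∀

    μ-of-spectrum : 1 ≤ μ → Σ ℕ λ t → μ ≡ n′ * t + suc a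
    μ-of-spectrum μ≥1 = k*x+a≡k*y+b⇒b≡k*t+a n′ (α * M) ((N + 1) * μ)
      (trans (sym (F*α≡ α)) (trans F*α≡N*D (ring n′ μ)))
      (subst (_≤ n′ + μ) (ℕ.+-comm α 1) (ℕ.+-mono-≤ α≤n′ μ≥1))
      where
      ring : ∀ b μ → suc b * (suc b * μ) ≡ b * ((suc b + 1) * μ) + μ
      ring = solve-∀
      ring′ : ∀ a l l* → l + l* + a + suc a ≡ l + l* + 2 * a + 1
      ring′ = solve-∀
      α≤n′ : α ≤ n′
      α≤n′ = subst (α ≤_) (trans (ring′ a l l*) (sym n′≡)) (ℕ.m≤n+m α (l + l* + a))

    α*M≡-of-spectrum : ∀ {t} → .{{NonZero n′}} → μ ≡ n′ * t + suc a → α * M ≡ t * (N * N) + α * (N + 1)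
    α*M≡-of-spectrum {t} μ≡ = ℕ.*-cancelˡ-≡ _ _ n′
      (ℕ.+-cancelʳ-≡ α _ _ (trans (sym (F*α≡ α)) (trans F*α≡N*D (N*D≡ t α μ≡))))

    quadruple-of-spectral : 1 ≤ n′ → 1 ≤ μ →
      Σ ℕ λ t → Admissible (suc a , l , l* , t) × Realizes (suc a) l l* t (params M N μ b v r k lam lam₁ lam₂)
    quadruple-of-spectral n′≥1 μ≥1 = t , (s≤s z≤n , admissible-of-spectrum , α∣[l+l*]²t) , record
      { n≡ = N≡
      ; α*m≡ = α*M≡
      ; μ≡ = μ≡
      ; b≡ = trans b≡B (sym M*N≡B)
      ; α*v≡ = Equivalence.from (α*v≡N*N*μ⇔v≡F F*α≡N*D) v≡F
      ; r≡ = r≡M*s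
      ; α*k≡ = α*k≡
      ; lam+nμ≡r = lam+D≡r
      ; α*lam₁≡ = Equivalence.from (α*lam₁≡N*μ*l⇔k≡lam₁+D α*k≡) k≡lam₁+D
      ; lam₂≡ = lam₂≡lam₁+μ
      }
      where
      instance
        n′-nonZero : NonZero n′
        n′-nonZero = >-nonZero n′≥1
      t : ℕ
      t = proj₁ (μ-of-spectrum μ≥1)
      μ≡ : μ ≡ n′ * t + α
      μ≡ = proj₂ (μ-of-spectrum μ≥1)
      α*M≡ : α * M ≡ t * (N * N) + α * (N + 1)
      α*M≡ = α*M≡-of-spectrum μ≡
      α*k≡ : α * k ≡ N * μ * (α + l)
      α*k≡ = Equivalence.from (α*k≡N*μ*s⇔N*k≡s*F F*α≡N*D) N*k≡s*F
      ring : ∀ t L α → t * ((L + 2 * α) * (L + 2 * α)) ≡ α * (4 * t * (L + α)) + L * (L * 1) * t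
      ring = solve-∀
      α∣[l+l*]²t : α ∣ (l + l*) ^ 2 * t
      α∣[l+l*]²t = ∣m+n∣m⇒∣n
        (subst (α ∣_) (trans (cong (λ z → t * (z * z)) N≡) (ring t (l + l*) α))
          (∣m+n∣m⇒∣n (subst (α ∣_) (trans α*M≡ (ℕ.+-comm (t * (N * N)) (α * (N + 1)))) (m∣m*n M))
            (m∣m*n (N + 1))))
        (m∣m*n _)

  realizes-of-spectral : ∀ {α s s₂ b v r k lam lam₁ lam₂} → 1 ≤ n′ → 1 ≤ μ →
    Spectrum α s s₂ → α ≤ s → α ≤ s₂ → SpectralRoot s b v r k lam lam₁ lam₂ →
    Σ ℕ λ a → Σ ℕ λ l → Σ ℕ λ l* → Σ ℕ λ t →
      Admissible (suc a , l , l* , t) × Realizes (suc a) l l* t (params M N μ b v r k lam lam₁ lam₂)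
  realizes-of-spectral {zero} _ μ≥1 S _ _ _
    with subst (1 ≤_) (trans (sym (Spectrum.F*α≡N*D S)) (ℕ.*-zeroʳ F)) (1≤N*D μ≥1)
  ... | ()
  realizes-of-spectral {suc a} n′≥1 μ≥1 S α≤s α≤s₂ R
    with ℕ.m≤n⇒∃[o]m+o≡n α≤s | ℕ.m≤n⇒∃[o]m+o≡n α≤s₂
  ... | l , refl | l* , refl = a , l , l* , quadruple-of-spectral S R n′≥1 μ≥1

-- The correspondence between admissible quadruples and feasible parameter sets

module _ {a l l* t : ℕ} {p : Params} (R : Realizes (suc a) l l* t p) where

  open Realizes R

  n≡suc[n′] : n p ≡ suc (l + l* + 2 * a + 1)
  n≡suc[n′] = trans n≡ (n≡suc[n∸1] a l l*)

  μ≡n′*t+α : μ p ≡ (l + l* + 2 * a + 1) * t + suc a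
  μ≡n′*t+α = trans μ≡ (cong (λ z → (z ∸ 1) * t + suc a) n≡suc[n′])

  realizes-1≤μ : 1 ≤ μ p
  realizes-1≤μ = subst (1 ≤_) (sym μ≡n′*t+α) (ℕ.≤-trans (s≤s z≤n) (ℕ.m≤n+m (suc a) _))

  realizes-n<m : n p < m p
  realizes-n<m = ℕ.*-cancelˡ-≤ (suc a) (begin
    suc a * suc (n p)                                   ≡⟨ cong (suc a *_) (ℕ.+-comm 1 (n p)) ⟩
    suc a * (n p + 1)                                   ≤⟨ ℕ.m≤n+m _ (t * (n p * n p)) ⟩
    t * (n p * n p) + suc a * (n p + 1)                 ≡⟨ sym α*m≡ ⟩
    suc a * m p                                         ∎)
    where open ℕ.≤-Reasoning

realizes-swap : ∀ {a l l* t p p*} → Realizes (suc a) l l* t p → Realizes (suc a) l* l t p* →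
  (m p* ≡ m p) × (n p* ≡ n p) × (μ p* ≡ μ p)
realizes-swap {a} {l} {l*} {t} {p} {p*} R R* = em , en , eμ
  where
  module R = Realizes R
  module R* = Realizes R*
  en : n p* ≡ n p
  en = trans R*.n≡ (trans (cong (_+ 2 * suc a) (ℕ.+-comm l* l)) (sym R.n≡))
  eμ : μ p* ≡ μ p
  eμ = trans R*.μ≡ (trans (cong (λ z → (z ∸ 1) * t + suc a) en) (sym R.μ≡))
  em : m p* ≡ m p
  em = ℕ.*-cancelˡ-≡ _ _ (suc a)
    (trans R*.α*m≡ (trans (cong (λ z → t * (z * z) + suc a * (z + 1)) en) (sym R.α*m≡)))

feasible-of-realizes : ∀ {a l l* t} p p* → l * l* ≡ suc a * a →
  Realizes (suc a) l l* t p → Realizes (suc a) l* l t p* → FeasibleSRD p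
feasible-of-realizes (params zero _ _ _ _ _ _ _ _ _) _ _ R _ with realizes-n<m R
... | ()
feasible-of-realizes (params (suc _) zero _ _ _ _ _ _ _ _) _ _ R _ with n≡suc[n′] R
... | ()
feasible-of-realizes {a} {l} {l*} (params (suc m′) (suc n′) μ _ _ _ _ _ _ _) (params _ _ _ _ _ _ _ _ _ _)
  l*l*≡ R R* with realizes-swap R R*
... | refl , refl , refl =
  Multipartite.srd-of-spectral m′ n′ μ 1≤m′ 1≤n′ (realizes-1≤μ R)
    (spectrum-of-realizes m′ n′ μ l*l*≡ R) (spectralRoot-of-realizes m′ n′ μ l*l*≡ R)
    (spectralRoot-of-realizes m′ n′ μ (trans (ℕ.*-comm l* l) l*l*≡) R*)
  where
  1≤n′ : 1 ≤ n′
  1≤n′ = subst (1 ≤_) (sym (ℕ.suc-injective (n≡suc[n′] R))) (ℕ.m≤n+m 1 _)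
  1≤m′ : 1 ≤ m′
  1≤m′ = ℕ.≤-trans (s≤s z≤n) (ℕ.≤-pred (realizes-n<m R))

realization : ∀ p → FeasibleSRD p →
  Σ ℕ λ a → Σ ℕ λ l → Σ ℕ λ l* → Σ ℕ λ t → Admissible (suc a , l , l* , t) × Realizes (suc a) l l* t p
realization (params zero _ _ _ _ _ _ _ _ _) (() , _)
realization (params (suc _) zero _ _ _ _ _ _ _ _) (_ , () , _)
realization (params (suc m′) (suc n′) μ _ _ _ _ _ _ _) srd@(_ , s≤s 1≤n′ , 1≤μ , _) =
  let (_ , _ , _ , S , α≤s , α≤s₂ , root) = Multipartite.spectral-of-srd m′ n′ μ srd
  in realizes-of-spectral m′ n′ μ 1≤n′ 1≤μ S α≤s α≤s₂ root

realizes-injective : ∀ {a l l* t a′ l′ l*′ t′ p} → l * l* ≡ suc a * a → l′ * l*′ ≡ suc a′ * a′ →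
  Realizes (suc a) l l* t p → Realizes (suc a′) l′ l*′ t′ p →
  (suc a , l , l* , t) ≡ (suc a′ , l′ , l*′ , t′)
realizes-injective {a} {l} {l*} {t} {a′} {l′} {l*′} {t′} {p} l*l*≡ l′*l*′≡ R R′ =
  cong₂ _,_ α≡α′ (cong₂ _,_ l≡l′ (cong₂ _,_ l*≡l*′ t≡t′))
  where
  module R = Realizes R
  module R′ = Realizes R′
  instance
    m-nonZero : NonZero (m p)
    m-nonZero = >-nonZero (ℕ.≤-trans (s≤s z≤n) (realizes-n<m R))
    n′-nonZero : NonZero (l + l* + 2 * a + 1)
    n′-nonZero = subst NonZero (ℕ.+-comm 1 _) _
  ring : ∀ a l l* → l + l* + 2 * suc a ≡ (suc a + l) + (suc a + l*)
  ring = solve-∀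
  s≡ : suc a + l ≡ suc a′ + l′
  s≡ = ℕ.*-cancelˡ-≡ _ _ (m p) (trans (sym R.r≡) R′.r≡)
  s*≡ : suc a + l* ≡ suc a′ + l*′
  s*≡ = ℕ.+-cancelˡ-≡ (suc a + l) _ _
    (trans (sym (ring a l l*)) (trans (trans (sym R.n≡) R′.n≡) (trans (ring a′ l′ l*′) (cong (_+ (suc a′ + l*′)) (sym s≡)))))
  n′≡ : l + l* + 2 * a + 1 ≡ l′ + l*′ + 2 * a′ + 1
  n′≡ = ℕ.suc-injective (trans (sym (n≡suc[n′] R)) (n≡suc[n′] R′))
  α≡α′ : suc a ≡ suc a′
  α≡α′ = ℕ.*-cancelʳ-≡ _ _ (l + l* + 2 * a + 1) (begin
    suc a * (l + l* + 2 * a + 1)         ≡⟨ sym (admissible-product a l l* l*l*≡) ⟩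
    (suc a + l) * (suc a + l*)           ≡⟨ cong₂ _*_ s≡ s*≡ ⟩
    (suc a′ + l′) * (suc a′ + l*′)       ≡⟨ admissible-product a′ l′ l*′ l′*l*′≡ ⟩
    suc a′ * (l′ + l*′ + 2 * a′ + 1)     ≡⟨ cong (suc a′ *_) (sym n′≡) ⟩
    suc a′ * (l + l* + 2 * a + 1)        ∎)
    where open ≡-Reasoning
  l≡l′ : l ≡ l′
  l≡l′ = ℕ.+-cancelˡ-≡ (suc a) _ _ (trans s≡ (cong (_+ l′) (sym α≡α′)))
  l*≡l*′ : l* ≡ l*′
  l*≡l*′ = ℕ.+-cancelˡ-≡ (suc a) _ _ (trans s*≡ (cong (_+ l*′) (sym α≡α′)))
  t≡t′ : t ≡ t′
  t≡t′ = ℕ.*-cancelˡ-≡ _ _ (l + l* + 2 * a + 1) (ℕ.+-cancelʳ-≡ (suc a) _ _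
    (trans (sym (μ≡n′*t+α R)) (trans (μ≡n′*t+α R′) (cong₂ (λ x y → x * t′ + y) (sym n′≡) (sym α≡α′)))))

1≡[q∸1]*0+1 : ∀ q → 1 ≡ (q ∸ 1) * 0 + 1
1≡[q∸1]*0+1 q = cong (_+ 1) (sym (ℕ.*-zeroʳ (q ∸ 1)))

realizes-affinePlane : ∀ l* → Realizes 1 0 l* 0 (affinePlane (l* + 2))
realizes-affinePlane l* = record
  { n≡ = refl ; α*m≡ = refl ; μ≡ = 1≡[q∸1]*0+1 q ; b≡ = ℕ.*-comm q (q + 1)
  ; α*v≡ = ring₁ q ; r≡ = ring₂ q ; α*k≡ = ring₃ q ; lam+nμ≡r = ring₄ q ; α*lam₁≡ = sym (ring₅ q) ; lam₂≡ = refl }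
  where
  q : ℕ
  q = l* + 2
  ring₁ : ∀ q → 1 * (q * q) ≡ q * q * 1
  ring₁ = solve-∀
  ring₂ : ∀ q → q + 1 ≡ (q + 1) * (1 + 0)
  ring₂ = solve-∀
  ring₃ : ∀ q → 1 * q ≡ q * 1 * (1 + 0)
  ring₃ = solve-∀
  ring₄ : ∀ q → 1 + q * 1 ≡ q + 1
  ring₄ = solve-∀
  ring₅ : ∀ q → q * 1 * 0 ≡ 1 * 0
  ring₅ = solve-∀

realizes-affineComplement : ∀ l → Realizes 1 l 0 0 (affineComplement (l + 2))
realizes-affineComplement l = record
  { n≡ = cong (_+ 2) (sym (ℕ.+-identityʳ l)) ; α*m≡ = refl ; μ≡ = 1≡[q∸1]*0+1 q ; b≡ = ℕ.*-comm q (q + 1)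
  ; α*v≡ = ring₁ q ; r≡ = r≡ ; α*k≡ = trans (ℕ.*-identityˡ _) qq∸q≡
  ; lam+nμ≡r = lam+nμ≡r ; α*lam₁≡ = trans (ℕ.*-identityˡ _) (m≡n+o⇒m∸o≡n (ring₅ l)) ; lam₂≡ = refl }
  where
  open ≡-Reasoning
  q : ℕ
  q = l + 2
  ring₁ : ∀ q → 1 * (q * q) ≡ q * q * 1
  ring₁ = solve-∀
  ring₂ : ∀ l → (l + 2) * (l + 2) ≡ (l + 2 + 1) * (1 + l) + 1
  ring₂ = solve-∀
  ring₃ : ∀ l → (l + 2) * (l + 2) ≡ (l + 2) * 1 * (1 + l) + (l + 2)
  ring₃ = solve-∀
  ring₄ : ∀ l → (l + 2) * 1 * (1 + l) ≡ l * l + 3 * l + 1 + 1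
  ring₄ = solve-∀
  ring₅ : ∀ l → (l + 2) * (l + 2) ≡ (l + 2) * 1 * l + 2 * (l + 2)
  ring₅ = solve-∀
  ring₆ : ∀ l → l * l + 3 * l + 1 + (l + 2) * 1 ≡ (l + 2 + 1) * (1 + l)
  ring₆ = solve-∀
  r≡ : q * q ∸ 1 ≡ (q + 1) * (1 + l)
  r≡ = m≡n+o⇒m∸o≡n (ring₂ l)
  qq∸q≡ : q * q ∸ q ≡ q * 1 * (1 + l)
  qq∸q≡ = m≡n+o⇒m∸o≡n (ring₃ l)
  lam+nμ≡r : q * q ∸ q ∸ 1 + q * 1 ≡ q * q ∸ 1
  lam+nμ≡r = begin
    q * q ∸ q ∸ 1 + q * 1              ≡⟨ cong (λ z → z ∸ 1 + q * 1) qq∸q≡ ⟩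
    q * 1 * (1 + l) ∸ 1 + q * 1        ≡⟨ cong (_+ q * 1) (m≡n+o⇒m∸o≡n (ring₄ l)) ⟩
    l * l + 3 * l + 1 + q * 1          ≡⟨ ring₆ l ⟩
    (q + 1) * (1 + l)                  ≡⟨ sym r≡ ⟩
    q * q ∸ 1                          ∎

affine-of-realizes : ∀ {a l l* t p} → l * l* ≡ suc a * a → Realizes (suc a) l l* t p → μ p ≡ 1 →
  Σ ℕ λ q → (2 ≤ q) × ((p ≡ affinePlane q) ⊎ (p ≡ affineComplement q))
affine-of-realizes {a} {l} {l*} {t} l*l*≡ R μ≡1 with a≡0 | t≡0
  where
  instance
    n′-nonZero : NonZero (l + l* + 2 * a + 1)
    n′-nonZero = subst NonZero (ℕ.+-comm 1 _) _
  n′*t+a≡0 : (l + l* + 2 * a + 1) * t + a ≡ 0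
  n′*t+a≡0 = ℕ.suc-injective (trans (sym (ℕ.+-suc _ a)) (trans (sym (μ≡n′*t+α R)) μ≡1))
  a≡0 : a ≡ 0
  a≡0 = ℕ.m+n≡0⇒n≡0 _ n′*t+a≡0
  t≡0 : t ≡ 0
  t≡0 = ℕ.m*n≡0⇒m≡0 t (l + l* + 2 * a + 1) (trans (ℕ.*-comm t _) (ℕ.m+n≡0⇒m≡0 _ n′*t+a≡0))
... | refl | refl with ℕ.m*n≡0⇒m≡0∨n≡0 l l*l*≡
...   | inj₁ refl = l* + 2 , ℕ.m≤n+m 2 l* , inj₁ (realizes-unique R (realizes-affinePlane l*))
...   | inj₂ refl = l + 2 , ℕ.m≤n+m 2 l , inj₂ (realizes-unique R (realizes-affineComplement l))

factor≤ : ∀ {a x y n′ t d} → 1 < d → x * y ≡ suc a * a → n′ * t + suc a ≡ d → x ≤ n′ → x ≤ d * d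
factor≤ {a} {x} {_} {n′} {suc t′} {d} 1<d _ e x≤n′ = begin
  x                      ≤⟨ x≤n′ ⟩
  n′                     ≤⟨ ℕ.m≤m*n n′ (suc t′) ⟩
  n′ * suc t′            ≤⟨ ℕ.m≤m+n _ (suc a) ⟩
  n′ * suc t′ + suc a    ≡⟨ e ⟩
  d                      ≤⟨ ℕ.m≤m*n d d {{>-nonZero (ℕ.<-trans (s≤s z≤n) 1<d)}} ⟩
  d * d                  ∎
  where open ℕ.≤-Reasoning
factor≤ {a} {x} {suc y′} {n′} {zero} {d} _ xy≡ e _ = begin
  x                      ≤⟨ ℕ.m≤m*n x (suc y′) ⟩
  x * suc y′             ≡⟨ xy≡ ⟩
  suc a * a              ≤⟨ ℕ.*-mono-≤ α≤d (ℕ.≤-trans (ℕ.n≤1+n a) α≤d) ⟩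
  d * d                  ∎
  where
  open ℕ.≤-Reasoning
  α≤d : suc a ≤ d
  α≤d = subst (suc a ≤_) e (ℕ.m≤n+m (suc a) (n′ * 0))
factor≤ {a} {x} {zero} {n′} {zero} {d} 1<d xy≡ e _ = ⊥-elim (ℕ.<-irrefl refl (subst (1 <_) d≡1 1<d))
  where
  a≡0 : a ≡ 0
  a≡0 = ℕ.m*n≡0⇒m≡0 a (suc a) (trans (ℕ.*-comm a (suc a)) (trans (sym xy≡) (ℕ.*-zeroʳ x)))
  d≡1 : d ≡ 1
  d≡1 = trans (sym e) (cong₂ (λ u w → u + suc w) (ℕ.*-zeroʳ n′) a≡0)

quadruples : ℕ → List Quad
quadruples B = cartesianProduct range (cartesianProduct range (cartesianProduct range range))
  where
  range : List ℕ
  range = upTo (suc B)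

quadruple-bounded : ∀ {a l l* t d} → 1 < d → l * l* ≡ suc a * a → (l + l* + 2 * a + 1) * t + suc a ≡ d →
  (suc a , l , l* , t) ∈ quadruples (d * d)
quadruple-bounded {a} {l} {l*} {t} {d} 1<d l*l*≡ e =
  ∈-cartesianProduct⁺ (in-range α≤) (∈-cartesianProduct⁺ (in-range l≤)
    (∈-cartesianProduct⁺ (in-range l*≤) (in-range t≤)))
  where
  open ℕ.≤-Reasoning
  n′ : ℕ
  n′ = l + l* + 2 * a + 1
  instance
    n′-nonZero : NonZero n′
    n′-nonZero = subst NonZero (ℕ.+-comm 1 _) _
    d-nonZero : NonZero d
    d-nonZero = >-nonZero (ℕ.<-trans (s≤s z≤n) 1<d)
  in-range : ∀ {x} → x ≤ d * d → x ∈ upTo (suc (d * d))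
  in-range x≤ = ∈-upTo⁺ (s≤s x≤)
  d≤d*d : d ≤ d * d
  d≤d*d = ℕ.m≤m*n d d
  α≤ : suc a ≤ d * d
  α≤ = ℕ.≤-trans (subst (suc a ≤_) e (ℕ.m≤n+m (suc a) (n′ * t))) d≤d*d
  t≤ : t ≤ d * d
  t≤ = begin
    t                 ≤⟨ ℕ.m≤n*m t n′ ⟩
    n′ * t            ≤⟨ ℕ.m≤m+n _ (suc a) ⟩
    n′ * t + suc a    ≡⟨ e ⟩
    d                 ≤⟨ d≤d*d ⟩
    d * d             ∎
  l≤ : l ≤ d * d
  l≤ = factor≤ 1<d l*l*≡ e (ℕ.≤-trans (ℕ.m≤m+n l l*) (ℕ.≤-trans (ℕ.m≤m+n _ (2 * a)) (ℕ.m≤m+n _ 1)))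
  l*≤ : l* ≤ d * d
  l*≤ = factor≤ 1<d (trans (ℕ.*-comm l* l) l*l*≡) e
    (ℕ.≤-trans (ℕ.m≤n+m l* l) (ℕ.≤-trans (ℕ.m≤m+n _ (2 * a)) (ℕ.m≤m+n _ 1)))

feasible-assign : (q : Quad) → Admissible q → FeasibleSRD (assign q)
feasible-assign (zero , _) (() , _)
feasible-assign (suc a , l , l* , t) (_ , l*l*≡ , α∣) =
  feasible-of-realizes _ _ l*l*≡ (assign-realizes a l l* t l*l*≡ α∣)
    (assign-realizes a l* l t (trans (ℕ.*-comm l* l) l*l*≡) (subst (λ z → suc a ∣ z ^ 2 * t) (ℕ.+-comm l l*) α∣))

assign-injective : (q q′ : Quad) → Admissible q → Admissible q′ → assign q ≡ assign q′ → q ≡ q′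
assign-injective (zero , _) _ (() , _) _ _
assign-injective _ (zero , _) _ (() , _) _
assign-injective (suc a , l , l* , t) (suc a′ , l′ , l*′ , t′) (_ , l*l*≡ , α∣) (_ , l′*l*′≡ , α′∣) e =
  realizes-injective l*l*≡ l′*l*′≡ (assign-realizes a l l* t l*l*≡ α∣)
    (subst (Realizes (suc a′) l′ l*′ t′) (sym e) (assign-realizes a′ l′ l*′ t′ l′*l*′≡ α′∣))

assign-surjective : (p : Params) → FeasibleSRD p → Σ Quad λ q → Admissible q × assign q ≡ p
assign-surjective p srd =
  let (a , l , l* , t , adm@(_ , l*l*≡ , α∣) , R) = realization p srd
  in (suc a , l , l* , t) , adm , realizes-unique (assign-realizes a l l* t l*l*≡ α∣) R

defect-one : (p : Params) → FeasibleSRD p → μ p ≡ 1 →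
  Σ ℕ λ q → (2 ≤ q) × ((p ≡ affinePlane q) ⊎ (p ≡ affineComplement q))
defect-one p srd μ≡1 =
  let (_ , _ , _ , _ , (_ , l*l*≡ , _) , R) = realization p srd
  in affine-of-realizes l*l*≡ R μ≡1

finitely-many : (d : ℕ) → 1 < d →
  Σ (List Params) λ L → (p : Params) → FeasibleSRD p → μ p ≡ d → p ∈ L
finitely-many d 1<d = map assign (quadruples (d * d)) , λ p srd μ≡d →
  let (a , l , l* , t , (_ , l*l*≡ , α∣) , R) = realization p srd
  in subst (_∈ map assign (quadruples (d * d))) (realizes-unique (assign-realizes a l l* t l*l*≡ α∣) R)
       (∈-map⁺ assign (quadruple-bounded {a} {l} {l*} {t} 1<d l*l*≡ (trans (sym (μ≡n′*t+α R)) μ≡d)))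

corollary2p4 :
    ((a : Quad) → Admissible a → FeasibleSRD (assign a))
    × ((a a′ : Quad) → Admissible a → Admissible a′ → assign a ≡ assign a′ → a ≡ a′)
    × ((p : Params) → FeasibleSRD p → Σ Quad λ a → Admissible a × assign a ≡ p)
    × ((p : Params) → FeasibleSRD p → μ p ≡ 1 →
        Σ ℕ λ q → (2 ≤ q) × ((p ≡ affinePlane q) ⊎ (p ≡ affineComplement q)))
    × ((d : ℕ) → 1 < d →
        Σ (List Params) λ L → (p : Params) → FeasibleSRD p → μ p ≡ d → p ∈ L)
corollary2p4 = feasible-assign , assign-injective , assign-surjective , defect-one , finitely-many
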